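{- Let $G$ be a finite looped simple graph with vertex set $V(G)$ and adjacency matrix $A(G)$ over $GF(2)$. Let $M(IA(G))$ be the binary matroid represented by the $|V(G)|\times 2|V(G)|$ matrix $IA(G)=(I\mid A(G))$ over $GF(2)$, with ground set $W(G)=\{v_\phi,v_\chi\mid v\in V(G)\}$, where $v_\phi$ is the column of $I$ indexed by $v$ and $v_\chi$ is the column of $A(G)$ indexed by $v$; let $r^G$ denote its rank function. Let $P$ be the polynomial ring over $\mathbb{Z}$ in independent indeterminates $s,z$ and $a(w),b(w)$ for $w\in W(G)$, and let $$\tau(M(IA(G)))=\sum_{T\subseteq W(G)}\Big(\prod_{t\in T}a(t)\Big)\Big(\prod_{w\notin T}b(w)\Big)s^{r^G(W(G))-r^G(T)}z^{|T|-r^G(T)}\in P$$ be the parametrized rank polynomial. Let $J$ be the ideal of $P$ generated by $\{a(v_\phi)a(v_\chi),\ b(v_\phi)b(v_\chi)\mid v\in V(G)\}$, $\pi:P\to P/J$ the quotient map, and $A\subseteq P$ the additive subgroup generated by the products $\big(\prod_{t\in T}a(t)\big)\big(\prod_{w\notin T}b(w)\big)(sz)^k$ with $k\ge 0$ and $T\in\mathcal{T}(W(G))$, where $\mathcal{T}(W(G))$ is the set of $T\subseteq W(G)$ with $|T\cap\{v_\phi,v_\chi\}|=1$ for all $v\in V(G)$. Then $\pi$ restricted to $A$ is injective, $\pi\tau(M(IA(G)))\in\pi(A)$, and $$\pi^{ -1}\pi\tau(M(IA(G)))=\sum_{T\in\mathcal{T}(W(G))}\Big(\prod_{t\in T}a(t)\Big)\Big(\prod_{w\notin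 T}b(w)\Big)(sz)^{|V(G)|-r^G(T)}.$$ Moreover, substituting $a(v_\phi)=1$, $a(v_\chi)=x-1$, $b(v_\phi)=b(v_\chi)=1$ for all $v\in V(G)$, $s=y-1$ and $z=1/(x-1)$ into this polynomial yields (in the field $\mathbb{Q}(x,y)$) the two-variable interlace polynomial $$q(G)=\sum_{S\subseteq V(G)}(x-1)^{r(A(G)[S])}(y-1)^{|S|-r(A(G)[S])},$$ where $r(A(G)[S])$ is the $GF(2)$-rank of the principal submatrix of $A(G)$ with rows and columns indexed by $S$.
   Context: A looped simple graph $G$ has a finite vertex set, some vertices declared looped, and some pairs of distinct vertices declared neighbors. Its adjacency matrix $A(G)$ is the $V(G)\times V(G)$ matrix over $GF(2)$ whose diagonal entry at $v$ is $1$ iff $v$ is looped and whose off-diagonal entry at $(u,v)$ is $1$ iff $u,v$ are neighbors. In the binary matroid represented by a matrix, the rank of a set of columns is the dimension of their $GF(2)$-span. $\pi^{ -1}$ denotes the inverse of the group isomorphism $\pi|_A:A\to\pi(A)$. -}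

module Defs where

open import Data.Bool using (Bool; true; false; _∧_; _∨_; _xor_; not; if_then_else_)
open import Data.Nat as ℕ using (ℕ; zero; suc; _∸_; _⊔_)
open import Data.Integer as ℤ using (ℤ; +_)
open import Data.Fin as Fin using (Fin; zero; suc; _↑ˡ_; _↑ʳ_; splitAt)
open import Data.Fin.Properties as FinP using ()
open import Data.Vec as Vec using (Vec; []; _∷_; lookup; tabulate; zipWith; replicate)
open import Data.Vec.Properties using (≡-dec)
open import Data.Nat.Properties as ℕP using ()
open import Data.List as List using (List; []; _∷_; _++_; map; concatMap; filterᵇ; foldr; allFin)
open import Data.List.Relation.Unary.All using (All)
open import Data.Product using (Σ; _×_; _,_; proj₁; proj₂)
open import Data.Sum using (inj₁; inj₂)
open import Relation.Binary.PropositionalEquality using (_≡_)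
open import Relation.Nullary.Decidable using (⌊_⌋)

-- Looped simple graphs on vertex set Fin n: the adjacency matrix A(G)
-- over GF(2) (Bool, with xor as addition), symmetric; the diagonal
-- entry adj v v records whether v is looped.

record LoopedGraph (n : ℕ) : Set where
  field
    adj : Fin n → Fin n → Bool
    adj-sym : ∀ u v → adj u v ≡ adj v u
open LoopedGraph public

Sub : ℕ → Set
Sub m = Vec Bool m

allSubsets : ∀ m → List (Sub m)
allSubsets zero = [] ∷ []
allSubsets (suc m) = concatMap (λ S → (false ∷ S) ∷ (true ∷ S) ∷ []) (allSubsets m)

elems : ∀ {m} → Sub m → List (Fin m)
elems {m} S = filterᵇ (λ i → lookup S i) (allFin m)

nonElems : ∀ {m} → Sub m → List (Fin m)
nonElems {m} S = filterᵇ (λ i → not (lookup S i)) (allFin m)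

size : ∀ {m} → Sub m → ℕ
size S = List.length (elems S)

allB : ∀ {m} → (Fin m → Bool) → Bool
allB {m} p = foldr (λ i b → p i ∧ b) true (allFin m)

anyB : ∀ {m} → (Fin m → Bool) → Bool
anyB {m} p = foldr (λ i b → p i ∨ b) false (allFin m)

_⊆ᵇ_ : ∀ {m} → Sub m → Sub m → Bool
S ⊆ᵇ T = allB (λ i → not (lookup S i) ∨ lookup T i)

subsetsOf : ∀ {m} → Sub m → List (Sub m)
subsetsOf {m} T = filterᵇ (λ S → S ⊆ᵇ T) (allSubsets m)

GF2Vec : ℕ → Set
GF2Vec n = Vec Bool n

zeroV : ∀ {n} → GF2Vec n
zeroV = replicate _ false

addV : ∀ {n} → GF2Vec n → GF2Vec n → GF2Vec n
addV = zipWith _xor_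

isZeroV : ∀ {n} → GF2Vec n → Bool
isZeroV v = allB (λ i → not (lookup v i))

sumCols : ∀ {m n} → (Fin m → GF2Vec n) → Sub m → GF2Vec n
sumCols col S = foldr (λ i acc → addV (col i) acc) zeroV (elems S)

independent : ∀ {m n} → (Fin m → GF2Vec n) → Sub m → Bool
independent col S =
  foldr _∧_ true (map (λ S' → not (anyB (lookup S')) ∨ not (isZeroV (sumCols col S'))) (subsetsOf S))

rank : ∀ {m n} → (Fin m → GF2Vec n) → Sub m → ℕ
rank col T = foldr _⊔_ 0 (map size (filterᵇ (independent col) (subsetsOf T)))

-- The matroid M(IA(G)); ground set W(G) = Fin (n + n),
-- v_φ = v ↑ˡ n (column of I), v_χ = n ↑ʳ v (column of A(G)).

W : ℕ → Set
W n = Fin (n ℕ.+ n)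

φ : ∀ {n} → Fin n → W n
φ {n} v = v ↑ˡ n

χ : ∀ {n} → Fin n → W n
χ {n} v = n ↑ʳ v

colIA : ∀ {n} → LoopedGraph n → W n → GF2Vec n
colIA {n} G w with splitAt n w
... | inj₁ v = tabulate (λ u → ⌊ u Fin.≟ v ⌋)
... | inj₂ v = tabulate (λ u → adj G u v)

rG : ∀ {n} → LoopedGraph n → Sub (n ℕ.+ n) → ℕ
rG G T = rank (colIA G) T

-- Polynomials over ℤ in k indeterminates (indexed by Fin k):
-- finite formal sums of terms c·x^e; equality = equality of all coefficients.

Mono : ℕ → Set
Mono k = Vec ℕ k

Poly : ℕ → Set
Poly k = List (ℤ × Mono k)

coeff : ∀ {k} → Poly k → Mono k → ℤ
coeff p m = foldr (λ t acc → (if ⌊ ≡-dec ℕP._≟_ (proj₂ t) m ⌋ then proj₁ t else + 0) ℤ.+ acc) (+ 0) p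

infix 4 _≈P_
_≈P_ : ∀ {k} → Poly k → Poly k → Set
p ≈P q = ∀ m → coeff p m ≡ coeff q m

constP : ∀ {k} → ℤ → Poly k
constP c = (c , replicate _ 0) ∷ []

0P 1P : ∀ {k} → Poly k
0P = []
1P = constP (+ 1)

infixl 6 _+P_ _-P_
infixl 7 _*P_
infixr 8 _^P_

_+P_ : ∀ {k} → Poly k → Poly k → Poly k
p +P q = p ++ q

-P_ : ∀ {k} → Poly k → Poly k
-P p = map (λ t → ℤ.- proj₁ t , proj₂ t) p

_-P_ : ∀ {k} → Poly k → Poly k → Poly k
p -P q = p +P (-P q)

_*P_ : ∀ {k} → Poly k → Poly k → Poly k
p *P q = concatMap (λ t → map (λ u → proj₁ t ℤ.* proj₁ u , zipWith ℕ._+_ (proj₂ t) (proj₂ u)) q) p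

_^P_ : ∀ {k} → Poly k → ℕ → Poly k
p ^P zero = 1P
p ^P suc e = p *P (p ^P e)

varP : ∀ {k} → Fin k → Poly k
varP i = (+ 1 , tabulate (λ j → if ⌊ i Fin.≟ j ⌋ then 1 else 0)) ∷ []

sumP : ∀ {k} → List (Poly k) → Poly k
sumP = foldr _+P_ 0P

prodP : ∀ {k} → List (Poly k) → Poly k
prodP = foldr _*P_ 1P

NV : ℕ → ℕ
NV n = 2 ℕ.+ ((n ℕ.+ n) ℕ.+ (n ℕ.+ n))

PP : ℕ → Set
PP n = Poly (NV n)

sV zV : ∀ {n} → Fin (NV n)
sV = zero
zV = suc zero

aV bV : ∀ {n} → W n → Fin (NV n)
aV {n} w = suc (suc (w ↑ˡ (n ℕ.+ n)))
bV {n} w = suc (suc ((n ℕ.+ n) ↑ʳ w))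

s z : ∀ {n} → PP n
s {n} = varP (sV {n})
z {n} = varP (zV {n})

a b : ∀ {n} → W n → PP n
a {n} w = varP (aV {n} w)
b {n} w = varP (bV {n} w)

monoT : ∀ {n} → Sub (n ℕ.+ n) → PP n
monoT {n} T = prodP (map (a {n}) (elems T)) *P prodP (map (b {n}) (nonElems T))

tau : ∀ {n} → LoopedGraph n → PP n
tau {n} G = sumP (map (λ T → monoT {n} T *P ( s {n} ^P (rG G (replicate _ true) ∸ rG G T))
                                     *P (z {n} ^P (size T ∸ rG G T)))
                      (allSubsets (n ℕ.+ n)))

inCalT : ∀ {n} → Sub (n ℕ.+ n) → Bool
inCalT {n} T = allB {n} (λ v → lookup T (φ v) xor lookup T (χ v))

InA : (n : ℕ) → PP n → Set
InA n p = Σ (List (ℤ × Sub (n ℕ.+ n) × ℕ)) λ L →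
  All (λ t → inCalT {n} (proj₁ (proj₂ t)) ≡ true) L ×
  (p ≈P sumP (map (λ t → constP (proj₁ t) *P monoT {n} (proj₁ (proj₂ t)) *P ((s {n} *P z {n}) ^P proj₂ (proj₂ t))) L))

InJ : (n : ℕ) → PP n → Set
InJ n p = Σ (Fin n → PP n × PP n) λ f →
  p ≈P sumP (map (λ v → proj₁ (f v) *P (a {n} (φ v) *P a {n} (χ v)) +P proj₂ (f v) *P (b {n} (φ v) *P b {n} (χ v))) (allFin n))

SameModJ : (n : ℕ) → PP n → PP n → Set
SameModJ n p q = InJ n (p -P q)

rhs : ∀ {n} → LoopedGraph n → PP n
rhs {n} G = sumP (map (λ T → monoT {n} T *P ((s {n} *P z {n}) ^P (n ∸ rG G T)))
                      (filterᵇ (inCalT {n}) (allSubsets (n ℕ.+ n))))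

-- ℚ(x,y) as the field of fractions of ℤ[x,y] (= Poly 2)

Frac : Set
Frac = Poly 2 × Poly 2

infix 4 _≃F_
_≃F_ : Frac → Frac → Set
(p , q) ≃F (p' , q') = p *P q' ≈P p' *P q

xP yP : Poly 2
xP = varP zero
yP = varP (suc zero)

constF : ℤ → Frac
constF c = constP c , 1P

_+F_ _*F_ : Frac → Frac → Frac
(p , q) +F (p' , q') = p *P q' +P p' *P q , q *P q'
(p , q) *F (p' , q') = p *P p' , q *P q'

_^F_ : Frac → ℕ → Frac
f ^F zero = constF (+ 1)
f ^F suc e = f *F (f ^F e)

evalF : ∀ {k} → (Fin k → Frac) → Poly k → Frac
evalF {k} σ p = foldr _+F_ (constF (+ 0))
  (map (λ t → constF (proj₁ t) *F foldr _*F_ (constF (+ 1)) (map (λ i → σ i ^F lookup (proj₂ t) i) (allFin k))) p)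

subst : (n : ℕ) → Fin (NV n) → Frac
subst n zero = yP -P 1P , 1P
subst n (suc zero) = 1P , xP -P 1P
subst n (suc (suc i)) with splitAt (n ℕ.+ n) i
... | inj₂ _ = constF (+ 1)
... | inj₁ w with splitAt n w
...   | inj₁ _ = constF (+ 1)
...   | inj₂ _ = xP -P 1P , 1P

principalRank : ∀ {n} → LoopedGraph n → Sub n → ℕ
principalRank G S = rank (λ v → zipWith _∧_ S (tabulate (λ u → adj G u v))) S

interlaceQ : ∀ {n} → LoopedGraph n → Poly 2
interlaceQ {n} G = sumP (map (λ S → (xP -P 1P) ^P principalRank G S
                                     *P (yP -P 1P) ^P (size S ∸ principalRank G S))
                             (allSubsets n))

module Submission where

open import Defs
open import Data.Nat using (ℕ)
open import Data.Product using (Σ; _×_; _,_)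

-- Split τ(M(IA(G))) = Σ_T term(T) according to whether T is a transversal (one of v_φ, v_χ for every v).
-- For a transversal |T| = n = r(W), so the powers of s and z in its term agree and it is a term of the
-- claimed polynomial; otherwise some v is unbalanced in T and the term is a multiple of a(v_φ)a(v_χ) or
-- b(v_φ)b(v_χ), so it lies in J.  π is injective on A because the monomials occurring in A are divisible
-- by no generator of J, while every monomial occurring in J is.  For the interlace polynomial, the
-- transversal T with χ-part S has rank |V ∖ S| + r(A[S]): the φ-columns outside S together with a column
-- basis of A[S] are independent and span T (Steinitz).  Hence n − r(T) = |S| − r(A[S]), and the
-- substitution turns the term of T into (x−1)^{r(A[S])} (y−1)^{|S|−r(A[S])}.

module PolynomialRing where

  open import Level using (0ℓ)
  open import Algebra.Bundles using (CommutativeRing)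
  open import Algebra.Structures using (IsCommutativeRing)
  open import Data.Bool using (true; false; if_then_else_)
  open import Data.Nat as ℕ using (ℕ)
  import Data.Nat.Properties as ℕP
  open import Data.Integer using (ℤ; +_; _+_; _*_; -_)
  import Data.Integer.Properties as ℤP
  open import Data.Integer.Tactic.RingSolver using (solve-∀)
  open import Data.Vec using (zipWith; replicate)
  open import Data.Vec.Properties using (≡-dec; zipWith-comm; zipWith-assoc; zipWith-identityˡ)
  open import Data.List using (List; []; _∷_; _++_; map; foldr; deduplicate)
  import Data.List.Properties as ListP
  open import Data.List.Relation.Unary.All as All using (All; []; _∷_)
  open import Data.List.Relation.Unary.Any using (here; there)
  open import Data.List.Membership.Propositional using (_∈_)
  open import Data.List.Membership.Propositional.Properties using (∈-map⁺; ∈-++⁺ˡ; ∈-++⁺ʳ; ∈-deduplicate⁺)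
  open import Data.List.Relation.Unary.Unique.Propositional using (Unique)
  open import Data.List.Relation.Unary.Unique.DecPropositional.Properties using (deduplicate-!)
  open import Data.List.Relation.Unary.AllPairs using (_∷_)
  open import Data.Product using (_,_; proj₁; proj₂)
  open import Relation.Binary.PropositionalEquality
  open import Relation.Nullary using (Dec; yes; no)
  open import Relation.Nullary.Decidable using (⌊_⌋)
  open import Data.Empty using (⊥-elim)

  -- A polynomial p is known through the functionals ev h p = Σ c · h(μ) over its terms (c, μ):
  -- ev (δ m) p is the coefficient of m, and conversely every ev h p is a finite linear combination of
  -- coefficients.  So ≈P is equality of all functionals, and every ring law becomes an identity in ℤ.

  _≟M_ : ∀ {k} (μ ν : Mono k) → Dec (μ ≡ ν)
  _≟M_ = ≡-dec ℕP._≟_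

  infixl 6 _⊕_
  _⊕_ : ∀ {k} → Mono k → Mono k → Mono k
  _⊕_ = zipWith ℕ._+_

  ev : ∀ {k} → (Mono k → ℤ) → Poly k → ℤ
  ev h [] = + 0
  ev h (t ∷ p) = proj₁ t * h (proj₂ t) + ev h p

  δ : ∀ {k} → Mono k → Mono k → ℤ
  δ m μ = if ⌊ μ ≟M m ⌋ then + 1 else + 0

  sumZ : List ℤ → ℤ
  sumZ = foldr _+_ (+ 0)

  if-then-0≡*-if : ∀ b c → (if b then c else + 0) ≡ c * (if b then + 1 else + 0)
  if-then-0≡*-if true c = sym (ℤP.*-identityʳ c)
  if-then-0≡*-if false c = sym (ℤP.*-zeroʳ c)

  coeff≡ev : ∀ {k} (p : Poly k) m → coeff p m ≡ ev (δ m) p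
  coeff≡ev [] m = refl
  coeff≡ev (t ∷ p) m = cong₂ _+_ (if-then-0≡*-if ⌊ proj₂ t ≟M m ⌋ (proj₁ t)) (coeff≡ev p m)

  ev-++ : ∀ {k} h (p q : Poly k) → ev h (p ++ q) ≡ ev h p + ev h q
  ev-++ h [] q = sym (ℤP.+-identityˡ _)
  ev-++ h (t ∷ p) q = trans (cong (λ w → proj₁ t * h (proj₂ t) + w) (ev-++ h p q))
                            (sym (ℤP.+-assoc (proj₁ t * h (proj₂ t)) (ev h p) (ev h q)))

  ev-cong : ∀ {k} {h h' : Mono k → ℤ} → (∀ μ → h μ ≡ h' μ) → ∀ p → ev h p ≡ ev h' p
  ev-cong e [] = refl
  ev-cong e (t ∷ p) = cong₂ _+_ (cong (λ w → proj₁ t * w) (e (proj₂ t))) (ev-cong e p)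

  sumZ-cong : ∀ {A : Set} {f g : A → ℤ} (D : List A) → (∀ x → f x ≡ g x) → sumZ (map f D) ≡ sumZ (map g D)
  sumZ-cong [] e = refl
  sumZ-cong (y ∷ D) e = cong₂ _+_ (e y) (sumZ-cong D e)

  sumZ-+ : ∀ {A : Set} (f g : A → ℤ) (D : List A) →
    sumZ (map (λ x → f x + g x) D) ≡ sumZ (map f D) + sumZ (map g D)
  sumZ-+ f g [] = refl
  sumZ-+ f g (y ∷ D) = trans (cong (λ w → f y + g y + w) (sumZ-+ f g D))
    (interchange (f y) (g y) (sumZ (map f D)) (sumZ (map g D)))
    where
    interchange : ∀ a b c d → a + b + (c + d) ≡ a + c + (b + d)
    interchange = solve-∀

  sumZ-0* : ∀ {k} (h : Mono k → ℤ) (D : List (Mono k)) → sumZ (map (λ μ → + 0 * h μ) D) ≡ + 0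
  sumZ-0* h [] = refl
  sumZ-0* h (y ∷ D) = cong₂ _+_ (ℤP.*-zeroˡ (h y)) (sumZ-0* h D)

  module _ {k} (x : Mono k) (c : ℤ) (h : Mono k → ℤ) where

    private
      point : Mono k → ℤ
      point μ = (if ⌊ x ≟M μ ⌋ then c else + 0) * h μ

    sumZ-point-∉ : (D : List (Mono k)) → All (x ≢_) D → sumZ (map point D) ≡ + 0
    sumZ-point-∉ [] [] = refl
    sumZ-point-∉ (y ∷ D) (x≢y ∷ x∉D) with x ≟M y
    ... | yes x≡y = ⊥-elim (x≢y x≡y)
    ... | no _ = trans (cong (λ w → + 0 * h y + w) (sumZ-point-∉ D x∉D)) (ℤP.+-identityʳ _ ∙ ℤP.*-zeroˡ (h y))
      where _∙_ = trans

    sumZ-point : (D : List (Mono k)) → Unique D → x ∈ D → sumZ (map point D) ≡ c * h x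
    sumZ-point (y ∷ D) (x∉D ∷ _) (here refl) with x ≟M x
    ... | no x≢x = ⊥-elim (x≢x refl)
    ... | yes _ = trans (cong (λ w → c * h x + w) (sumZ-point-∉ D x∉D))
                        (ℤP.+-identityʳ _)
    sumZ-point (y ∷ D) (y∉D ∷ D!) (there x∈D) with x ≟M y
    ... | yes refl = ⊥-elim (All.lookup y∉D x∈D refl)
    ... | no _ = trans (cong₂ _+_ (ℤP.*-zeroˡ (h y)) (sumZ-point D D! x∈D)) (ℤP.+-identityˡ _)

  ev-over-support : ∀ {k} (h : Mono k → ℤ) (D : List (Mono k)) → Unique D → (p : Poly k) →
    All (λ t → proj₂ t ∈ D) p → ev h p ≡ sumZ (map (λ μ → coeff p μ * h μ) D)
  ev-over-support h D D! [] [] = sym (sumZ-0* h D)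
  ev-over-support h D D! (t ∷ p) (t∈D ∷ p⊆D) = begin
      proj₁ t * h (proj₂ t) + ev h p
    ≡⟨ cong₂ _+_ (sym (sumZ-point (proj₂ t) (proj₁ t) h D D! t∈D)) (ev-over-support h D D! p p⊆D) ⟩
      sumZ (map head D) + sumZ (map (λ μ → coeff p μ * h μ) D)
    ≡⟨ sym (sumZ-+ head _ D) ⟩
      sumZ (map (λ μ → head μ + coeff p μ * h μ) D)
    ≡⟨ sumZ-cong D (λ μ → sym (ℤP.*-distribʳ-+ (h μ) (if ⌊ proj₂ t ≟M μ ⌋ then proj₁ t else + 0) (coeff p μ))) ⟩
      sumZ (map (λ μ → coeff (t ∷ p) μ * h μ) D) ∎
    where
    open ≡-Reasoning
    head : Mono _ → ℤ
    head μ = (if ⌊ proj₂ t ≟M μ ⌋ then proj₁ t else + 0) * h μ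

  ≈P⇒ev≡ : ∀ {k} (h : Mono k → ℤ) (p q : Poly k) → p ≈P q → ev h p ≡ ev h q
  ≈P⇒ev≡ h p q p≈q = begin
      ev h p                                  ≡⟨ ev-over-support h D D! p p⊆D ⟩
      sumZ (map (λ μ → coeff p μ * h μ) D)    ≡⟨ sumZ-cong D (λ μ → cong (_* h μ) (p≈q μ)) ⟩
      sumZ (map (λ μ → coeff q μ * h μ) D)    ≡⟨ sym (ev-over-support h D D! q q⊆D) ⟩
      ev h q                                  ∎
    where
    open ≡-Reasoning
    D = deduplicate _≟M_ (map proj₂ p ++ map proj₂ q)
    D! = deduplicate-! _≟M_ (map proj₂ p ++ map proj₂ q)
    support = ∈-deduplicate⁺ _≟M_
    p⊆D = All.tabulate (λ t∈p → support (∈-++⁺ˡ (∈-map⁺ proj₂ t∈p)))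
    q⊆D = All.tabulate (λ t∈q → support (∈-++⁺ʳ (map proj₂ p) (∈-map⁺ proj₂ t∈q)))

  ev≡⇒≈P : ∀ {k} (p q : Poly k) → (∀ h → ev h p ≡ ev h q) → p ≈P q
  ev≡⇒≈P p q f m = trans (coeff≡ev p m) (trans (f (δ m)) (sym (coeff≡ev q m)))

  ev-*+ : ∀ {k} (a : ℤ) (f g : Mono k → ℤ) p → ev (λ ν → a * f ν + g ν) p ≡ a * ev f p + ev g p
  ev-*+ a f g [] = sym (trans (ℤP.+-identityʳ (a * + 0)) (ℤP.*-zeroʳ a))
  ev-*+ a f g (t ∷ p) rewrite ev-*+ a f g p = lemma (proj₁ t) a (f (proj₂ t)) (g (proj₂ t)) (ev f p) (ev g p)
    where
    lemma : ∀ c a x y F G → c * (a * x + y) + (a * F + G) ≡ a * (c * x + F) + (c * y + G)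
    lemma = solve-∀

  ev-+ : ∀ {k} (f g : Mono k → ℤ) p → ev (λ ν → f ν + g ν) p ≡ ev f p + ev g p
  ev-+ f g p = trans (ev-cong (λ ν → cong (_+ g ν) (sym (ℤP.*-identityˡ (f ν)))) p)
                     (trans (ev-*+ (+ 1) f g p) (cong (_+ ev g p) (ℤP.*-identityˡ (ev f p))))

  ev-0 : ∀ {k} (p : Poly k) → ev (λ _ → + 0) p ≡ + 0
  ev-0 [] = refl
  ev-0 (t ∷ p) rewrite ev-0 p = trans (ℤP.+-identityʳ _) (ℤP.*-zeroʳ (proj₁ t))

  ev-shift : ∀ {k} h c (μ : Mono k) (q : Poly k) →
    ev h (map (λ u → c * proj₁ u , μ ⊕ proj₂ u) q) ≡ c * ev (λ ν → h (μ ⊕ ν)) q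
  ev-shift h c μ [] = sym (ℤP.*-zeroʳ c)
  ev-shift h c μ (u ∷ q) rewrite ev-shift h c μ q = lemma c (proj₁ u) (h (μ ⊕ proj₂ u)) (ev (λ ν → h (μ ⊕ ν)) q)
    where
    lemma : ∀ c d x E → c * d * x + c * E ≡ c * (d * x + E)
    lemma = solve-∀

  ev-* : ∀ {k} h (p q : Poly k) → ev h (p *P q) ≡ ev (λ μ → ev (λ ν → h (μ ⊕ ν)) q) p
  ev-* h [] q = refl
  ev-* h (t ∷ p) q = trans (ev-++ h (map (λ u → proj₁ t * proj₁ u , proj₂ t ⊕ proj₂ u) q) (p *P q))
                           (cong₂ _+_ (ev-shift h (proj₁ t) (proj₂ t) q) (ev-* h p q))

  ev-neg : ∀ {k} h (p : Poly k) → ev h (-P p) ≡ - ev h p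
  ev-neg h [] = refl
  ev-neg h (t ∷ p) rewrite ev-neg h p =
    trans (cong (_+ - ev h p) (sym (ℤP.neg-distribˡ-* (proj₁ t) (h (proj₂ t)))))
          (sym (ℤP.neg-distrib-+ (proj₁ t * h (proj₂ t)) (ev h p)))

  ev-swap : ∀ {k} (κ : Mono k → Mono k → ℤ) (p q : Poly k) →
    ev (λ μ → ev (κ μ) q) p ≡ ev (λ ν → ev (λ μ → κ μ ν) p) q
  ev-swap κ [] q = sym (ev-0 q)
  ev-swap κ (t ∷ p) q = trans (cong (λ w → proj₁ t * ev (κ (proj₂ t)) q + w) (ev-swap κ p q))
                              (sym (ev-*+ (proj₁ t) (κ (proj₂ t)) (λ ν → ev (λ μ → κ μ ν) p) q))

  ⊕-comm : ∀ {k} (μ ν : Mono k) → μ ⊕ ν ≡ ν ⊕ μ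
  ⊕-comm = zipWith-comm ℕP.+-comm

  ⊕-assoc : ∀ {k} (μ ν ρ : Mono k) → (μ ⊕ ν) ⊕ ρ ≡ μ ⊕ (ν ⊕ ρ)
  ⊕-assoc = zipWith-assoc ℕP.+-assoc

  ⊕-identityˡ : ∀ {k} (μ : Mono k) → replicate k 0 ⊕ μ ≡ μ
  ⊕-identityˡ = zipWith-identityˡ ℕP.+-identityˡ

  -- ≈P is a pointwise function type, so Agda cannot infer its arguments; wrapping it in a record makes
  -- the ring laws usable with setoid reasoning.
  infix 4 _≋_
  record _≋_ {k} (p q : Poly k) : Set where
    constructor mk≋
    field get : p ≈P q
  open _≋_ public

  module _ {k : ℕ} where

    private
      byEv : (p q : Poly k) → (∀ h → ev h p ≡ ev h q) → p ≋ q
      byEv p q f = mk≋ (ev≡⇒≈P p q f)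

    +P-cong : ∀ {p p' q q' : Poly k} → p ≋ p' → q ≋ q' → p +P q ≋ p' +P q'
    +P-cong {p} {p'} {q} {q'} (mk≋ e) (mk≋ f) = byEv (p +P q) (p' +P q') λ h →
      trans (ev-++ h p q) (trans (cong₂ _+_ (≈P⇒ev≡ h p p' e) (≈P⇒ev≡ h q q' f)) (sym (ev-++ h p' q')))

    *P-cong : ∀ {p p' q q' : Poly k} → p ≋ p' → q ≋ q' → p *P q ≋ p' *P q'
    *P-cong {p} {p'} {q} {q'} (mk≋ e) (mk≋ f) = byEv (p *P q) (p' *P q') λ h →
      trans (ev-* h p q) (trans (≈P⇒ev≡ (λ μ → ev (λ ν → h (μ ⊕ ν)) q) p p' e)
        (trans (ev-cong (λ μ → ≈P⇒ev≡ (λ ν → h (μ ⊕ ν)) q q' f) p') (sym (ev-* h p' q'))))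

    -P-cong : ∀ {p q : Poly k} → p ≋ q → -P p ≋ -P q
    -P-cong {p} {q} (mk≋ e) = byEv (-P p) (-P q) λ h →
      trans (ev-neg h p) (trans (cong -_ (≈P⇒ev≡ h p q e)) (sym (ev-neg h q)))

    +P-assoc : ∀ (p q r : Poly k) → (p +P q) +P r ≋ p +P (q +P r)
    +P-assoc p q r = mk≋ (λ m → cong (λ l → coeff l m) (ListP.++-assoc p q r))

    +P-comm : ∀ (p q : Poly k) → p +P q ≋ q +P p
    +P-comm p q = byEv (p +P q) (q +P p) λ h →
      trans (ev-++ h p q) (trans (ℤP.+-comm (ev h p) (ev h q)) (sym (ev-++ h q p)))

    +P-identityʳ : ∀ (p : Poly k) → p +P 0P ≋ p
    +P-identityʳ p = mk≋ (λ m → cong (λ l → coeff l m) (ListP.++-identityʳ p))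

    -P-inverseˡ : ∀ (p : Poly k) → (-P p) +P p ≋ 0P
    -P-inverseˡ p = byEv ((-P p) +P p) 0P λ h →
      trans (ev-++ h (-P p) p) (trans (cong (_+ ev h p) (ev-neg h p)) (ℤP.+-inverseˡ (ev h p)))

    -P-inverseʳ : ∀ (p : Poly k) → p +P (-P p) ≋ 0P
    -P-inverseʳ p = byEv (p +P (-P p)) 0P λ h →
      trans (ev-++ h p (-P p)) (trans (cong (λ w → ev h p + w) (ev-neg h p)) (ℤP.+-inverseʳ (ev h p)))

    *P-comm : ∀ (p q : Poly k) → p *P q ≋ q *P p
    *P-comm p q = byEv (p *P q) (q *P p) λ h → trans (ev-* h p q) (trans (ev-swap (λ μ ν → h (μ ⊕ ν)) p q)
      (trans (ev-cong (λ ν → ev-cong (λ μ → cong h (⊕-comm μ ν)) p) q) (sym (ev-* h q p))))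

    *P-assoc : ∀ (p q r : Poly k) → (p *P q) *P r ≋ p *P (q *P r)
    *P-assoc p q r = byEv ((p *P q) *P r) (p *P (q *P r)) λ h → begin
        ev h ((p *P q) *P r)                                        ≡⟨ ev-* h (p *P q) r ⟩
        ev (λ ρ → ev (λ σ → h (ρ ⊕ σ)) r) (p *P q)                   ≡⟨ ev-* _ p q ⟩
        ev (λ μ → ev (λ ν → ev (λ σ → h ((μ ⊕ ν) ⊕ σ)) r) q) p
          ≡⟨ ev-cong (λ μ → ev-cong (λ ν → ev-cong (λ σ → cong h (⊕-assoc μ ν σ)) r) q) p ⟩
        ev (λ μ → ev (λ ν → ev (λ σ → h (μ ⊕ (ν ⊕ σ))) r) q) p     ≡⟨ ev-cong (λ μ → sym (ev-* (λ τ → h (μ ⊕ τ)) q r)) p ⟩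
        ev (λ μ → ev (λ τ → h (μ ⊕ τ)) (q *P r)) p                  ≡⟨ sym (ev-* h p (q *P r)) ⟩
        ev h (p *P (q *P r))                                        ∎
      where open ≡-Reasoning

    *P-identityˡ : ∀ (p : Poly k) → 1P *P p ≋ p
    *P-identityˡ p = byEv (1P *P p) p λ h → trans (ev-* h 1P p)
      (trans (ℤP.+-identityʳ _) (trans (ℤP.*-identityˡ _) (ev-cong (λ ν → cong h (⊕-identityˡ ν)) p)))

    *P-identityʳ : ∀ (p : Poly k) → p *P 1P ≋ p
    *P-identityʳ p = mk≋ (λ m → trans (get (*P-comm p 1P) m) (get (*P-identityˡ p) m))

    *P-distribˡ : ∀ (p q r : Poly k) → p *P (q +P r) ≋ p *P q +P p *P r
    *P-distribˡ p q r = byEv (p *P (q +P r)) (p *P q +P p *P r) λ h → begin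
        ev h (p *P (q +P r))                                                          ≡⟨ ev-* h p (q +P r) ⟩
        ev (λ μ → ev (λ ν → h (μ ⊕ ν)) (q ++ r)) p                                     ≡⟨ ev-cong (λ μ → ev-++ _ q r) p ⟩
        ev (λ μ → ev (λ ν → h (μ ⊕ ν)) q + ev (λ ν → h (μ ⊕ ν)) r) p                   ≡⟨ ev-+ _ _ p ⟩
        ev (λ μ → ev (λ ν → h (μ ⊕ ν)) q) p + ev (λ μ → ev (λ ν → h (μ ⊕ ν)) r) p      ≡⟨ sym (cong₂ _+_ (ev-* h p q) (ev-* h p r)) ⟩
        ev h (p *P q) + ev h (p *P r)                                                 ≡⟨ sym (ev-++ h (p *P q) (p *P r)) ⟩
        ev h (p *P q +P p *P r)                                                       ∎
      where open ≡-Reasoning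

    *P-distribʳ : ∀ (p q r : Poly k) → (q +P r) *P p ≋ q *P p +P r *P p
    *P-distribʳ p q r = byEv ((q +P r) *P p) (q *P p +P r *P p) λ h →
      trans (ev-* h (q ++ r) p) (trans (ev-++ _ q r)
        (trans (cong₂ _+_ (sym (ev-* h q p)) (sym (ev-* h r p))) (sym (ev-++ h (q *P p) (r *P p)))))

    ≋-isCommutativeRing : IsCommutativeRing (_≋_ {k}) _+P_ _*P_ -P_ 0P 1P
    ≋-isCommutativeRing = record
      { isRing = record
        { +-isAbelianGroup = record
          { isGroup = record
            { isMonoid = record
              { isSemigroup = record
                { isMagma = record
                  { isEquivalence = record
                    { refl = mk≋ (λ m → refl)
                    ; sym = λ e → mk≋ (λ m → sym (get e m))
                    ; trans = λ e f → mk≋ (λ m → trans (get e m) (get f m)) }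
                  ; ∙-cong = +P-cong }
                ; assoc = +P-assoc }
              ; identity = (λ p → mk≋ (λ m → refl)) , +P-identityʳ }
            ; inverse = -P-inverseˡ , -P-inverseʳ
            ; ⁻¹-cong = -P-cong }
          ; comm = +P-comm }
        ; *-cong = *P-cong
        ; *-assoc = *P-assoc
        ; *-identity = *P-identityˡ , *P-identityʳ
        ; distrib = *P-distribˡ , *P-distribʳ }
      ; *-comm = *P-comm }

  polynomialRing : ℕ → CommutativeRing 0ℓ 0ℓ
  polynomialRing k = record { isCommutativeRing = ≋-isCommutativeRing {k} }

module SumsOverFin where

  open import Algebra.Bundles using (CommutativeRing)
  import Data.Nat.Properties as ℕP
  open import Data.Bool using (Bool; true; false; _∧_; _∨_; _xor_; not)
  open import Data.Bool.Properties using (xor-assoc; ∧-comm; ∧-distribˡ-xor; xor-identityʳ; xor-∧-commutativeRing)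
  open import Algebra.Properties.CommutativeSemigroup (CommutativeRing.+-commutativeSemigroup xor-∧-commutativeRing)
    using (interchange)
  open import Algebra.Properties.CommutativeSemigroup ℕP.+-commutativeSemigroup
    renaming (interchange to +-interchange)
  open import Data.Nat using (ℕ; zero; suc; _+_)
  open import Data.Fin as Fin using (Fin; zero; suc; _↑ˡ_; _↑ʳ_)
  open import Data.Vec using (lookup)
  open import Data.Vec.Properties using (lookup-zipWith; lookup-replicate)
  open import Data.List as List using (List; []; _∷_; foldr; filterᵇ; allFin)
  open import Data.Product using (Σ; _,_)
  open import Relation.Binary.PropositionalEquality
  open import Relation.Nullary.Decidable using (⌊_⌋)
  open import Relation.Nullary using (yes; no)
  open import Data.Empty using (⊥-elim)

  ⊕F : ∀ m → (Fin m → Bool) → Bool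
  ⊕F zero f = false
  ⊕F (suc m) f = f zero xor ⊕F m (λ i → f (suc i))

  ΣN : ∀ m → (Fin m → ℕ) → ℕ
  ΣN zero f = 0
  ΣN (suc m) f = f zero + ΣN m (λ i → f (suc i))

  ind : Bool → ℕ
  ind true = 1
  ind false = 0

  ⊕F-cong : ∀ m {f g : Fin m → Bool} → (∀ i → f i ≡ g i) → ⊕F m f ≡ ⊕F m g
  ⊕F-cong zero e = refl
  ⊕F-cong (suc m) e = cong₂ _xor_ (e zero) (⊕F-cong m (λ i → e (suc i)))

  ⊕F-xor : ∀ m (f g : Fin m → Bool) → ⊕F m (λ i → f i xor g i) ≡ ⊕F m f xor ⊕F m g
  ⊕F-xor zero f g = refl
  ⊕F-xor (suc m) f g = trans (cong ((f zero xor g zero) xor_) (⊕F-xor m (λ i → f (suc i)) (λ i → g (suc i))))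
                             (interchange (f zero) (g zero) _ _)

  ⊕F-∧ˡ : ∀ m b (f : Fin m → Bool) → ⊕F m (λ i → b ∧ f i) ≡ b ∧ ⊕F m f
  ⊕F-∧ˡ zero false f = refl
  ⊕F-∧ˡ zero true f = refl
  ⊕F-∧ˡ (suc m) b f = trans (cong ((b ∧ f zero) xor_) (⊕F-∧ˡ m b _)) (sym (∧-distribˡ-xor b _ _))

  ⊕F-∧ʳ : ∀ m b (f : Fin m → Bool) → ⊕F m (λ i → f i ∧ b) ≡ ⊕F m f ∧ b
  ⊕F-∧ʳ m b f = trans (⊕F-cong m (λ i → ∧-comm (f i) b)) (trans (⊕F-∧ˡ m b f) (∧-comm b _))

  ⊕F-false : ∀ m (f : Fin m → Bool) → (∀ i → f i ≡ false) → ⊕F m f ≡ false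
  ⊕F-false zero f e = refl
  ⊕F-false (suc m) f e = trans (cong₂ _xor_ (e zero) (⊕F-false m _ (λ i → e (suc i)))) refl

  ⊕F-swap : ∀ m n (f : Fin m → Fin n → Bool) → ⊕F m (λ i → ⊕F n (f i)) ≡ ⊕F n (λ j → ⊕F m (λ i → f i j))
  ⊕F-swap zero n f = sym (⊕F-false n _ (λ _ → refl))
  ⊕F-swap (suc m) n f = trans (cong (⊕F n (f zero) xor_) (⊕F-swap m n (λ i → f (suc i)))) (sym (⊕F-xor n _ _))

  ⊕F-point : ∀ m (j : Fin m) (f : Fin m → Bool) → ⊕F m (λ i → ⌊ i Fin.≟ j ⌋ ∧ f i) ≡ f j
  ⊕F-point (suc m) zero f = trans (cong (f zero xor_) (⊕F-false m _ (λ i → refl))) (xor-identityʳ (f zero))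
  ⊕F-point (suc m) (suc j) f = trans (⊕F-cong m (λ i → cong (_∧ f (suc i)) (≟-suc i))) (⊕F-point m j (λ i → f (suc i)))
    where
    ≟-suc : ∀ i → ⌊ suc i Fin.≟ suc j ⌋ ≡ ⌊ i Fin.≟ j ⌋
    ≟-suc i with i Fin.≟ j
    ... | yes refl = refl
    ... | no _ = refl

  ⊕F-pointʳ : ∀ m (j : Fin m) (f : Fin m → Bool) → ⊕F m (λ i → f i ∧ ⌊ j Fin.≟ i ⌋) ≡ f j
  ⊕F-pointʳ m j f = trans (⊕F-cong m (λ i → trans (∧-comm (f i) _) (cong (_∧ f i) (≟-sym i)))) (⊕F-point m j f)
    where
    ≟-sym : ∀ i → ⌊ j Fin.≟ i ⌋ ≡ ⌊ i Fin.≟ j ⌋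
    ≟-sym i with j Fin.≟ i | i Fin.≟ j
    ... | yes _ | yes _ = refl
    ... | no _ | no _ = refl
    ... | yes e | no ne = ⊥-elim (ne (sym e))
    ... | no ne | yes e = ⊥-elim (ne (sym e))

  ⊕F-++ : ∀ a b (f : Fin (a + b) → Bool) → ⊕F (a + b) f ≡ ⊕F a (λ i → f (i ↑ˡ b)) xor ⊕F b (λ j → f (a ↑ʳ j))
  ⊕F-++ zero b f = refl
  ⊕F-++ (suc a) b f = trans (cong (f zero xor_) (⊕F-++ a b (λ i → f (suc i)))) (sym (xor-assoc (f zero) _ _))

  ΣN-cong : ∀ m {f g : Fin m → ℕ} → (∀ i → f i ≡ g i) → ΣN m f ≡ ΣN m g
  ΣN-cong zero e = refl
  ΣN-cong (suc m) e = cong₂ _+_ (e zero) (ΣN-cong m (λ i → e (suc i)))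

  ΣN-++ : ∀ a b (f : Fin (a + b) → ℕ) → ΣN (a + b) f ≡ ΣN a (λ i → f (i ↑ˡ b)) + ΣN b (λ j → f (a ↑ʳ j))
  ΣN-++ zero b f = refl
  ΣN-++ (suc a) b f = trans (cong (f zero +_) (ΣN-++ a b (λ i → f (suc i)))) (sym (ℕP.+-assoc (f zero) _ _))

  ΣN-+ : ∀ m (f g : Fin m → ℕ) → ΣN m (λ i → f i + g i) ≡ ΣN m f + ΣN m g
  ΣN-+ zero f g = refl
  ΣN-+ (suc m) f g = trans (cong (f zero + g zero +_) (ΣN-+ m (λ i → f (suc i)) (λ i → g (suc i))))
                           (+-interchange (f zero) (g zero) _ _)

  ΣN-1 : ∀ m → ΣN m (λ _ → 1) ≡ m
  ΣN-1 zero = refl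
  ΣN-1 (suc m) = cong suc (ΣN-1 m)

  ΣN-0 : ∀ m (f : Fin m → ℕ) → (∀ i → f i ≡ 0) → ΣN m f ≡ 0
  ΣN-0 zero f e = refl
  ΣN-0 (suc m) f e = cong₂ _+_ (e zero) (ΣN-0 m _ (λ i → e (suc i)))

  ΣN-point : ∀ m (j : Fin m) → ΣN m (λ i → ind ⌊ i Fin.≟ j ⌋) ≡ 1
  ΣN-point (suc m) zero = cong suc (ΣN-0 m _ (λ i → refl))
  ΣN-point (suc m) (suc j) = trans (ΣN-cong m (λ i → cong ind (≟-suc i))) (ΣN-point m j)
    where
    ≟-suc : ∀ i → ⌊ suc i Fin.≟ suc j ⌋ ≡ ⌊ i Fin.≟ j ⌋
    ≟-suc i with i Fin.≟ j
    ... | yes refl = refl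
    ... | no _ = refl

  foldr-tabulate-suc : ∀ {A : Set} m (c : Fin (suc m) → A → A) (e : A) →
    foldr c e (List.tabulate {n = m} suc) ≡ foldr (λ i → c (suc i)) e (allFin m)
  foldr-tabulate-suc m c e = go m (λ i → i)
    where
    go : ∀ k (f : Fin k → Fin m) → foldr c e (List.tabulate (λ i → suc (f i))) ≡ foldr (λ i → c (suc i)) e (List.tabulate f)
    go zero f = refl
    go (suc k) f = cong (c (suc (f zero))) (go k (λ i → f (suc i)))

  allB-suc : ∀ {m} (p : Fin (suc m) → Bool) → allB p ≡ p zero ∧ allB (λ i → p (suc i))
  allB-suc {m} p = cong (p zero ∧_) (foldr-tabulate-suc m (λ i b → p i ∧ b) true)

  anyB-suc : ∀ {m} (p : Fin (suc m) → Bool) → anyB p ≡ p zero ∨ anyB (λ i → p (suc i))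
  anyB-suc {m} p = cong (p zero ∨_) (foldr-tabulate-suc m (λ i b → p i ∨ b) false)

  allB⇒ : ∀ {m} (p : Fin m → Bool) → allB p ≡ true → ∀ i → p i ≡ true
  allB⇒ {suc m} p e i with p zero in p0 | allB-suc p
  allB⇒ {suc m} p e zero | true | _ = p0
  allB⇒ {suc m} p e (suc i) | true | eq = allB⇒ (λ i → p (suc i)) (trans (sym eq) e) i
  allB⇒ {suc m} p e i | false | eq with () ← trans (sym e) eq

  allB⇐ : ∀ {m} (p : Fin m → Bool) → (∀ i → p i ≡ true) → allB p ≡ true
  allB⇐ {zero} p h = refl
  allB⇐ {suc m} p h = trans (allB-suc p) (cong₂ _∧_ (h zero) (allB⇐ (λ i → p (suc i)) (λ i → h (suc i))))

  anyB⇒ : ∀ {m} (p : Fin m → Bool) → anyB p ≡ false → ∀ i → p i ≡ false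
  anyB⇒ {suc m} p e i with p zero in p0 | anyB-suc p
  anyB⇒ {suc m} p e zero | false | _ = p0
  anyB⇒ {suc m} p e (suc i) | false | eq = anyB⇒ (λ i → p (suc i)) (trans (sym eq) e) i
  anyB⇒ {suc m} p e i | true | eq with () ← trans (sym e) eq

  anyB⇐ : ∀ {m} (p : Fin m → Bool) → (∀ i → p i ≡ false) → anyB p ≡ false
  anyB⇐ {zero} p h = refl
  anyB⇐ {suc m} p h = trans (anyB-suc p) (cong₂ _∨_ (h zero) (anyB⇐ (λ i → p (suc i)) (λ i → h (suc i))))

  anyB-witness : ∀ {m} (p : Fin m → Bool) → anyB p ≡ true → Σ (Fin m) λ i → p i ≡ true
  anyB-witness {suc m} p e with p zero in p0 | anyB-suc p
  ... | true | _ = zero , p0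
  ... | false | eq = let (i , pi) = anyB-witness (λ i → p (suc i)) (trans (sym eq) e) in suc i , pi

  allB≡not-anyB-not : ∀ {m} (p : Fin m → Bool) → allB p ≡ not (anyB (λ i → not (p i)))
  allB≡not-anyB-not {zero} p = refl
  allB≡not-anyB-not {suc m} p = begin
      allB p                                                ≡⟨ allB-suc p ⟩
      p zero ∧ allB (λ i → p (suc i))                       ≡⟨ cong (p zero ∧_) (allB≡not-anyB-not (λ i → p (suc i))) ⟩
      p zero ∧ not (anyB (λ i → not (p (suc i))))           ≡⟨ de-Morgan (p zero) _ ⟩
      not (not (p zero) ∨ anyB (λ i → not (p (suc i))))     ≡⟨ cong not (sym (anyB-suc (λ i → not (p i)))) ⟩
      not (anyB (λ i → not (p i)))                          ∎
    where
    open ≡-Reasoning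
    de-Morgan : ∀ a b → a ∧ not b ≡ not (not a ∨ b)
    de-Morgan false b = refl
    de-Morgan true b = refl

  -- Stated for an arbitrary tabulated list (elems S filters allFin m) so that induction goes through.

  length-filter-tabulate : ∀ {A : Set} m (f : Fin m → A) (p : A → Bool) →
    List.length (filterᵇ p (List.tabulate f)) ≡ ΣN m (λ i → ind (p (f i)))
  length-filter-tabulate zero f p = refl
  length-filter-tabulate (suc m) f p with p (f zero)
  ... | true = cong suc (length-filter-tabulate m (λ i → f (suc i)) p)
  ... | false = length-filter-tabulate m (λ i → f (suc i)) p

  size≡ΣN : ∀ {m} (S : Sub m) → size S ≡ ΣN m (λ i → ind (lookup S i))
  size≡ΣN {m} S = length-filter-tabulate m (λ i → i) (lookup S)

  xor-filter-tabulate : ∀ {A : Set} m (f : Fin m → A) (p g : A → Bool) →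
    foldr (λ i b → g i xor b) false (filterᵇ p (List.tabulate f)) ≡ ⊕F m (λ i → p (f i) ∧ g (f i))
  xor-filter-tabulate zero f p g = refl
  xor-filter-tabulate (suc m) f p g with p (f zero)
  ... | true = cong (g (f zero) xor_) (xor-filter-tabulate m (λ i → f (suc i)) p g)
  ... | false = xor-filter-tabulate m (λ i → f (suc i)) p g

  lookup-sumCols : ∀ {m n} (col : Fin m → GF2Vec n) (S : Sub m) (r : Fin n) →
    lookup (sumCols col S) r ≡ ⊕F m (λ i → lookup S i ∧ lookup (col i) r)
  lookup-sumCols {m} col S r = trans (lookup-foldr (elems S)) (xor-filter-tabulate m (λ i → i) (lookup S) (λ i → lookup (col i) r))
    where
    lookup-foldr : ∀ L → lookup (foldr (λ i acc → addV (col i) acc) zeroV L) r ≡ foldr (λ i b → lookup (col i) r xor b) false L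
    lookup-foldr [] = lookup-replicate r false
    lookup-foldr (i ∷ L) = trans (lookup-zipWith _xor_ r (col i) _) (cong (lookup (col i) r xor_) (lookup-foldr L))

module Rank where

  open SumsOverFin
  open import Data.Bool using (Bool; true; false; _∧_; _∨_; not)
  open import Data.Bool.Properties using (∨-zeroʳ; T-≡)
  open import Relation.Nullary.Decidable using (T?)
  open import Function using (_∘_; Equivalence)
  open import Data.List.Membership.Propositional.Properties using (∈-filter⁺; ∈-filter⁻)
  open import Data.Nat using (ℕ; suc; _≤_; _⊔_; z≤n)
  import Data.Nat.Properties as ℕP
  open import Data.Fin using (Fin)
  open import Data.Vec using (Vec; []; _∷_; lookup; replicate)
  open import Data.Vec.Properties using (lookup-replicate)
  open import Data.List using (List; []; _∷_; map; foldr; filterᵇ; concatMap)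
  open import Data.List.Membership.Propositional using (_∈_)
  open import Data.List.Relation.Unary.Any using (here; there)
  open import Data.Product using (Σ; _×_; _,_; proj₂; map₂)
  open import Data.Sum using (inj₁; inj₂)
  open import Relation.Binary.PropositionalEquality renaming (subst to ≡subst)

  infix 4 _⊆_
  _⊆_ : ∀ {m} → Sub m → Sub m → Set
  S ⊆ T = ∀ i → lookup S i ≡ true → lookup T i ≡ true

  ∅ : ∀ {m} → Sub m
  ∅ = replicate _ false

  ∅⊆ : ∀ {m} (T : Sub m) → ∅ ⊆ T
  ∅⊆ T i e with () ← trans (sym (lookup-replicate i false)) e

  sumColsAt : ∀ {m n} → (Fin m → GF2Vec n) → Sub m → Fin n → Bool
  sumColsAt {m} col S r = ⊕F m (λ i → lookup S i ∧ lookup (col i) r)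

  Independent : ∀ {m n} → (Fin m → GF2Vec n) → Sub m → Set
  Independent col S = ∀ S' → S' ⊆ S → (∀ r → sumColsAt col S' r ≡ false) → ∀ i → lookup S' i ≡ false

  ∈-filterᵇ⁺ : ∀ {A : Set} (p : A → Bool) {x xs} → x ∈ xs → p x ≡ true → x ∈ filterᵇ p xs
  ∈-filterᵇ⁺ p x∈ px = ∈-filter⁺ (T? ∘ p) x∈ (Equivalence.from T-≡ px)

  ∈-filterᵇ⁻ : ∀ {A : Set} (p : A → Bool) {x} xs → x ∈ filterᵇ p xs → x ∈ xs × p x ≡ true
  ∈-filterᵇ⁻ p xs x∈ = map₂ (Equivalence.to T-≡) (∈-filter⁻ (T? ∘ p) x∈)

  ∈-allSubsets : ∀ {m} (S : Sub m) → S ∈ allSubsets m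
  ∈-allSubsets [] = here refl
  ∈-allSubsets {suc m} (b ∷ S) = ∈-doubled b (allSubsets m) (∈-allSubsets S)
    where
    ∈-doubled : ∀ b xs → S ∈ xs → (b ∷ S) ∈ concatMap (λ S' → (false ∷ S') ∷ (true ∷ S') ∷ []) xs
    ∈-doubled false (y ∷ xs) (here refl) = here refl
    ∈-doubled true (y ∷ xs) (here refl) = there (here refl)
    ∈-doubled b (y ∷ xs) (there S∈) = there (there (∈-doubled b xs S∈))

  ⊆ᵇ⇒⊆ : ∀ {m} (S T : Sub m) → S ⊆ᵇ T ≡ true → S ⊆ T
  ⊆ᵇ⇒⊆ S T e i Si with allB⇒ (λ i → not (lookup S i) ∨ lookup T i) e i
  ... | h rewrite Si = h

  ⊆⇒⊆ᵇ : ∀ {m} (S T : Sub m) → S ⊆ T → S ⊆ᵇ T ≡ true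
  ⊆⇒⊆ᵇ S T h = allB⇐ _ λ i → implication (lookup S i) (lookup T i) (h i)
    where
    implication : ∀ a b → (a ≡ true → b ≡ true) → not a ∨ b ≡ true
    implication false b f = refl
    implication true b f = f refl

  ∈-subsetsOf⁺ : ∀ {m} (S T : Sub m) → S ⊆ T → S ∈ subsetsOf T
  ∈-subsetsOf⁺ {m} S T S⊆T = ∈-filterᵇ⁺ (_⊆ᵇ T) (∈-allSubsets S) (⊆⇒⊆ᵇ S T S⊆T)

  ∈-subsetsOf⁻ : ∀ {m} (S T : Sub m) → S ∈ subsetsOf T → S ⊆ T
  ∈-subsetsOf⁻ {m} S T S∈ = ⊆ᵇ⇒⊆ S T (proj₂ (∈-filterᵇ⁻ (_⊆ᵇ T) (allSubsets m) S∈))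

  and-map⇒ : ∀ {A : Set} (g : A → Bool) xs → foldr _∧_ true (map g xs) ≡ true → ∀ {x} → x ∈ xs → g x ≡ true
  and-map⇒ g (y ∷ xs) e x∈ with g y in gy
  and-map⇒ g (y ∷ xs) e (here refl) | true = gy
  and-map⇒ g (y ∷ xs) e (there x∈) | true = and-map⇒ g xs e x∈

  and-map⇐ : ∀ {A : Set} (g : A → Bool) xs → (∀ {x} → x ∈ xs → g x ≡ true) → foldr _∧_ true (map g xs) ≡ true
  and-map⇐ g [] h = refl
  and-map⇐ g (y ∷ xs) h rewrite h (here refl) = and-map⇐ g xs (λ x∈ → h (there x∈))

  and-map-false : ∀ {A : Set} (g : A → Bool) xs → foldr _∧_ true (map g xs) ≡ false → Σ A λ x → x ∈ xs × g x ≡ false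
  and-map-false g (y ∷ xs) e with g y in gy
  ... | false = y , here refl , gy
  ... | true = let (x , x∈ , gx) = and-map-false g xs e in x , there x∈ , gx

  isZeroV⇒ : ∀ {m n} (col : Fin m → GF2Vec n) S → isZeroV (sumCols col S) ≡ true → ∀ r → sumColsAt col S r ≡ false
  isZeroV⇒ col S e r with allB⇒ _ e r
  ... | h rewrite lookup-sumCols col S r with sumColsAt col S r
  ... | false = refl

  isZeroV⇐ : ∀ {m n} (col : Fin m → GF2Vec n) S → (∀ r → sumColsAt col S r ≡ false) → isZeroV (sumCols col S) ≡ true
  isZeroV⇐ col S h = allB⇐ _ (λ r → cong not (trans (lookup-sumCols col S r) (h r)))

  independent⇒Independent : ∀ {m n} (col : Fin m → GF2Vec n) S → independent col S ≡ true → Independent col S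
  independent⇒Independent col S e S' S'⊆S sum≡0 = anyB⇒ (lookup S') (nonempty⇒false _ witness)
    where
    witness : not (anyB (lookup S')) ∨ not true ≡ true
    witness = ≡subst (λ b → not (anyB (lookup S')) ∨ not b ≡ true) (isZeroV⇐ col S' sum≡0)
                (and-map⇒ _ (subsetsOf S) e (∈-subsetsOf⁺ S' S S'⊆S))
    nonempty⇒false : ∀ a → not a ∨ false ≡ true → a ≡ false
    nonempty⇒false false _ = refl

  Independent⇒independent : ∀ {m n} (col : Fin m → GF2Vec n) S → Independent col S → independent col S ≡ true
  Independent⇒independent col S ind = and-map⇐ _ (subsetsOf S) λ {S'} S'∈ → noDependency S' (∈-subsetsOf⁻ S' S S'∈)
    where
    noDependency : ∀ S' → S' ⊆ S → not (anyB (lookup S')) ∨ not (isZeroV (sumCols col S')) ≡ true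
    noDependency S' S'⊆S with isZeroV (sumCols col S') in z
    ... | false = ∨-zeroʳ _
    ... | true rewrite anyB⇐ (lookup S') (ind S' S'⊆S (isZeroV⇒ col S' z)) = refl

  ≤-maximum : ∀ {A : Set} (f : A → ℕ) {x} xs → x ∈ xs → f x ≤ foldr _⊔_ 0 (map f xs)
  ≤-maximum f (y ∷ xs) (here refl) = ℕP.m≤m⊔n (f y) _
  ≤-maximum f (y ∷ xs) (there x∈) = ℕP.≤-trans (≤-maximum f xs x∈) (ℕP.m≤n⊔m (f y) _)

  maximum-lub : ∀ {A : Set} (f : A → ℕ) k xs → (∀ {x} → x ∈ xs → f x ≤ k) → foldr _⊔_ 0 (map f xs) ≤ k
  maximum-lub f k [] h = z≤n
  maximum-lub f k (y ∷ xs) h = ℕP.⊔-lub (h (here refl)) (maximum-lub f k xs (λ x∈ → h (there x∈)))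

  maximum-attained : ∀ {A : Set} (f : A → ℕ) y xs → Σ A λ x → x ∈ (y ∷ xs) × foldr _⊔_ 0 (map f (y ∷ xs)) ≡ f x
  maximum-attained f y [] = y , here refl , ℕP.⊔-identityʳ (f y)
  maximum-attained f y (y' ∷ xs) with maximum-attained f y' xs
  ... | (x , x∈ , e) with ℕP.≤-total (f y) (foldr _⊔_ 0 (map f (y' ∷ xs)))
  ... | inj₁ le = x , there x∈ , trans (ℕP.m≤n⇒m⊔n≡n le) e
  ... | inj₂ ge = y , here refl , ℕP.m≥n⇒m⊔n≡m ge

  rank-lowerBound : ∀ {m n} (col : Fin m → GF2Vec n) T X → X ⊆ T → Independent col X → size X ≤ rank col T
  rank-lowerBound col T X X⊆T ind =
    ≤-maximum size _ (∈-filterᵇ⁺ (independent col) (∈-subsetsOf⁺ X T X⊆T) (Independent⇒independent col X ind))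

  rank-upperBound : ∀ {m n} (col : Fin m → GF2Vec n) T k → (∀ X → X ⊆ T → Independent col X → size X ≤ k) → rank col T ≤ k
  rank-upperBound col T k h = maximum-lub size k _ λ {X} X∈ →
    let (X∈subsets , indep) = ∈-filterᵇ⁻ (independent col) (subsetsOf T) X∈
    in h X (∈-subsetsOf⁻ X T X∈subsets) (independent⇒Independent col X indep)

  ∅-Independent : ∀ {m n} (col : Fin m → GF2Vec n) → Independent col ∅
  ∅-Independent col S' S'⊆∅ _ i with lookup S' i in e
  ... | false = refl
  ... | true with () ← trans (sym (lookup-replicate i false)) (S'⊆∅ i e)

  maximalIndependentSubset : ∀ {m n} (col : Fin m → GF2Vec n) T →
    Σ (Sub m) λ B → B ⊆ T × Independent col B × size B ≡ rank col T
  maximalIndependentSubset col T with filterᵇ (independent col) (subsetsOf T) in eq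
  ... | [] with () ← ≡subst (∅ ∈_) eq (∈-filterᵇ⁺ (independent col) (∈-subsetsOf⁺ ∅ T (∅⊆ T))
                                         (Independent⇒independent col ∅ (∅-Independent col)))
  ... | y ∷ xs with maximum-attained size y xs
  ... | (B , B∈ , e) =
    let (B∈subsets , indep) = ∈-filterᵇ⁻ (independent col) (subsetsOf T) (≡subst (B ∈_) (sym eq) B∈)
    in B , ∈-subsetsOf⁻ B T B∈subsets , independent⇒Independent col B indep , sym e

module Steinitz where

  open SumsOverFin
  open Rank
  open import Data.Bool using (Bool; true; false; _∧_; _∨_; _xor_; not; T?)
  open import Data.Bool.Properties using (∧-assoc; ∧-distribʳ-xor; xor-same)
  open import Data.Nat using (zero; suc; _+_; _≤_; _^_; z≤n; s≤s)
  import Data.Nat.Properties as ℕP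
  open import Data.Nat.Tactic.RingSolver using (solve-∀)
  open import Data.Fin using (Fin; zero; suc)
  open import Data.Vec using (Vec; []; _∷_; lookup; tabulate; zipWith)
  open import Data.Vec.Properties using (lookup-zipWith; lookup∘tabulate; tabulate∘lookup; tabulate-cong)
  open import Data.List using (List; []; _∷_; _++_; map; filterᵇ; concatMap; length)
  open import Data.List.Properties using (length-++; length-map)
  open import Data.List.Membership.Propositional using (_∈_)
  open import Data.List.Membership.Propositional.Properties using (∈-++⁺ˡ; ∈-++⁺ʳ; ∈-++⁻; ∈-∃++; ∈-map⁺; ∈-map⁻)
  open import Data.List.Relation.Unary.Any using (here; there)
  open import Data.List.Relation.Unary.All as All using ([]; _∷_)
  open import Data.List.Relation.Unary.AllPairs using ([]; _∷_)
  open import Data.List.Relation.Unary.Unique.Propositional using (Unique)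
  open import Data.List.Relation.Unary.Unique.Propositional.Properties using (filter⁺)
  open import Data.Product using (Σ; _×_; _,_; proj₁; proj₂)
  open import Data.Sum using (_⊎_; inj₁; inj₂)
  open import Data.Empty using (⊥-elim)
  open import Function using (_∘_)
  open import Relation.Binary.PropositionalEquality renaming (subst to ≡subst)

  vec-ext : ∀ {A : Set} {m} (u v : Vec A m) → (∀ i → lookup u i ≡ lookup v i) → u ≡ v
  vec-ext u v h = trans (sym (tabulate∘lookup u)) (trans (tabulate-cong h) (tabulate∘lookup v))

  doubled : ∀ {A B : Set} → (A → B) → (A → B) → List A → List B
  doubled f g = concatMap (λ y → f y ∷ g y ∷ [])

  ∈-doubled⁻ : ∀ {A B : Set} (f g : A → B) {x} xs → x ∈ doubled f g xs → Σ A λ y → y ∈ xs × (x ≡ f y ⊎ x ≡ g y)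
  ∈-doubled⁻ f g (y ∷ xs) (here refl) = y , here refl , inj₁ refl
  ∈-doubled⁻ f g (y ∷ xs) (there (here refl)) = y , here refl , inj₂ refl
  ∈-doubled⁻ f g (y ∷ xs) (there (there x∈)) = let (z , z∈ , e) = ∈-doubled⁻ f g xs x∈ in z , there z∈ , e

  Unique-doubled : ∀ {A B : Set} (f g : A → B) → (∀ {x y} → f x ≡ f y → x ≡ y) → (∀ {x y} → g x ≡ g y → x ≡ y) →
    (∀ x y → f x ≢ g y) → ∀ xs → Unique xs → Unique (doubled f g xs)
  Unique-doubled f g f-inj g-inj f≢g [] [] = []
  Unique-doubled f g f-inj g-inj f≢g (y ∷ xs) (y∉xs ∷ xs!) =
    (f≢g y y ∷ All.tabulate (λ x∈ → let (z , z∈ , e) = ∈-doubled⁻ f g xs x∈ in fresh-f z z∈ e)) ∷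
    All.tabulate (λ x∈ → let (z , z∈ , e) = ∈-doubled⁻ f g xs x∈ in fresh-g z z∈ e) ∷
    Unique-doubled f g f-inj g-inj f≢g xs xs!
    where
    fresh-f : ∀ {x} z → z ∈ xs → (x ≡ f z ⊎ x ≡ g z) → f y ≢ x
    fresh-f z z∈ (inj₁ refl) e = All.lookup y∉xs z∈ (f-inj e)
    fresh-f z z∈ (inj₂ refl) e = f≢g y z e
    fresh-g : ∀ {x} z → z ∈ xs → (x ≡ f z ⊎ x ≡ g z) → g y ≢ x
    fresh-g z z∈ (inj₁ refl) e = f≢g z y (sym e)
    fresh-g z z∈ (inj₂ refl) e = All.lookup y∉xs z∈ (g-inj e)

  ∷-injectiveʳ : ∀ {A : Set} {m} {x y : A} {u v : Vec A m} → _≡_ {A = Vec A (suc m)} (x ∷ u) (y ∷ v) → u ≡ v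
  ∷-injectiveʳ refl = refl

  allSubsets-Unique : ∀ m → Unique (allSubsets m)
  allSubsets-Unique zero = [] ∷ []
  allSubsets-Unique (suc m) =
    Unique-doubled (false ∷_) (true ∷_) ∷-injectiveʳ ∷-injectiveʳ (λ x y ()) (allSubsets m) (allSubsets-Unique m)

  subsetsOf-Unique : ∀ {m} (T : Sub m) → Unique (subsetsOf T)
  subsetsOf-Unique {m} T = filter⁺ (T? ∘ (_⊆ᵇ T)) (allSubsets-Unique m)

  Unique-map⁺ : ∀ {A B : Set} (f : A → B) xs → Unique xs →
    (∀ {x y} → x ∈ xs → y ∈ xs → f x ≡ f y → x ≡ y) → Unique (map f xs)
  Unique-map⁺ f [] [] inj = []
  Unique-map⁺ f (y ∷ xs) (y∉xs ∷ xs!) inj =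
    All.tabulate (λ x∈ → let (z , z∈ , e) = ∈-map⁻ f x∈ in λ fy≡ → All.lookup y∉xs z∈ (inj (here refl) (there z∈) (trans fy≡ e))) ∷
    Unique-map⁺ f xs xs! (λ x∈ y∈ → inj (there x∈) (there y∈))

  pigeonhole : ∀ {A : Set} (L M : List A) → Unique L → (∀ {x} → x ∈ L → x ∈ M) → length L ≤ length M
  pigeonhole [] M _ _ = z≤n
  pigeonhole (x ∷ L) M (x∉L ∷ L!) L⊆M with ∈-∃++ (L⊆M (here refl))
  ... | (ys , zs , refl) = ≡subst (suc (length L) ≤_) (sym length-M) (s≤s (pigeonhole L (ys ++ zs) L! L⊆M-x))
    where
    length-M : length (ys ++ x ∷ zs) ≡ suc (length (ys ++ zs))
    length-M = trans (length-++ ys) (trans (ℕP.+-suc (length ys) (length zs)) (cong suc (sym (length-++ ys))))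
    L⊆M-x : ∀ {v} → v ∈ L → v ∈ ys ++ zs
    L⊆M-x v∈ with ∈-++⁻ ys (L⊆M (there v∈))
    ... | inj₁ v∈ys = ∈-++⁺ˡ v∈ys
    ... | inj₂ (here refl) = ⊥-elim (All.lookup x∉L v∈ refl)
    ... | inj₂ (there v∈zs) = ∈-++⁺ʳ ys v∈zs

  ⊆ᵇ-∷ : ∀ {m} b x (S T : Sub m) → (b ∷ S) ⊆ᵇ (x ∷ T) ≡ (not b ∨ x) ∧ (S ⊆ᵇ T)
  ⊆ᵇ-∷ b x S T = allB-suc (λ i → not (lookup (b ∷ S) i) ∨ lookup (x ∷ T) i)

  length-filter-doubled : ∀ {A B : Set} (P : B → Bool) (f g : A → B) xs →
    length (filterᵇ P (doubled f g xs)) ≡ length (filterᵇ (P ∘ f) xs) + length (filterᵇ (P ∘ g) xs)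
  length-filter-doubled P f g [] = refl
  length-filter-doubled P f g (y ∷ xs) = begin
      length (filterᵇ P (f y ∷ g y ∷ doubled f g xs))
    ≡⟨ trans (length-filter-∷ P (f y) _) (cong (ind (P (f y)) +_) (length-filter-∷ P (g y) _)) ⟩
      ind (P (f y)) + (ind (P (g y)) + length (filterᵇ P (doubled f g xs)))
    ≡⟨ cong (λ k → ind (P (f y)) + (ind (P (g y)) + k)) (length-filter-doubled P f g xs) ⟩
      ind (P (f y)) + (ind (P (g y)) + (length (filterᵇ (P ∘ f) xs) + length (filterᵇ (P ∘ g) xs)))
    ≡⟨ shuffle (ind (P (f y))) (ind (P (g y))) _ _ ⟩
      (ind (P (f y)) + length (filterᵇ (P ∘ f) xs)) + (ind (P (g y)) + length (filterᵇ (P ∘ g) xs))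
    ≡⟨ sym (cong₂ _+_ (length-filter-∷ (P ∘ f) y xs) (length-filter-∷ (P ∘ g) y xs)) ⟩
      length (filterᵇ (P ∘ f) (y ∷ xs)) + length (filterᵇ (P ∘ g) (y ∷ xs)) ∎
    where
    open ≡-Reasoning
    length-filter-∷ : ∀ {C : Set} (P : C → Bool) x ys → length (filterᵇ P (x ∷ ys)) ≡ ind (P x) + length (filterᵇ P ys)
    length-filter-∷ P x ys with P x
    ... | true = refl
    ... | false = refl
    shuffle : ∀ a b c d → a + (b + (c + d)) ≡ a + c + (b + d)
    shuffle = solve-∀

  filterᵇ-cong : ∀ {A : Set} {p q : A → Bool} xs → (∀ x → p x ≡ q x) → filterᵇ p xs ≡ filterᵇ q xs
  filterᵇ-cong [] h = refl
  filterᵇ-cong {p = p} {q} (y ∷ xs) h with p y | q y | h y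
  ... | true | true | refl = cong (y ∷_) (filterᵇ-cong xs h)
  ... | false | false | refl = filterᵇ-cong xs h

  filterᵇ-false : ∀ {A : Set} (xs : List A) → filterᵇ (λ _ → false) xs ≡ []
  filterᵇ-false [] = refl
  filterᵇ-false (x ∷ xs) = filterᵇ-false xs

  length-subsetsOf : ∀ {m} (T : Sub m) → length (subsetsOf T) ≡ 2 ^ size T
  length-subsetsOf T = trans (count T) (cong (2 ^_) (sym (size≡ΣN T)))
    where
    count : ∀ {m} (T : Sub m) → length (subsetsOf T) ≡ 2 ^ ΣN m (λ i → ind (lookup T i))
    count {zero} [] = refl
    count {suc m} (x ∷ T) =
      trans (length-filter-doubled (_⊆ᵇ (x ∷ T)) (false ∷_) (true ∷_) (allSubsets m))
       (trans (cong₂ _+_ (cong length (filterᵇ-cong (allSubsets m) (λ S → ⊆ᵇ-∷ false x S T)))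
                         (cong length (filterᵇ-cong (allSubsets m) (λ S → ⊆ᵇ-∷ true x S T))))
              (by-head x))
      where
      by-head : ∀ x → length (filterᵇ (λ S → (true ∨ x) ∧ (S ⊆ᵇ T)) (allSubsets m))
                      + length (filterᵇ (λ S → (false ∨ x) ∧ (S ⊆ᵇ T)) (allSubsets m))
                      ≡ 2 ^ (ind x + ΣN m (λ i → ind (lookup T i)))
      by-head false rewrite filterᵇ-false (allSubsets m) = trans (ℕP.+-identityʳ _) (count T)
      by-head true rewrite count T = cong (2 ^ ΣN m (λ i → ind (lookup T i)) +_) (sym (ℕP.+-identityʳ _))

  2^-cancel-≤ : ∀ a b → 2 ^ a ≤ 2 ^ b → a ≤ b
  2^-cancel-≤ a b le with ℕP.≤-<-connex a b
  ... | inj₁ a≤b = a≤b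
  ... | inj₂ b<a = ⊥-elim (ℕP.<⇒≱ (ℕP.^-monoʳ-< 2 (s≤s (s≤s z≤n)) b<a) le)

  ⊕F-witness : ∀ m (f : Fin m → Bool) → ⊕F m f ≡ true → Σ (Fin m) λ i → f i ≡ true
  ⊕F-witness (suc m) f e with f zero in f0
  ... | true = zero , f0
  ... | false = let (i , fi) = ⊕F-witness m (λ i → f (suc i)) e in suc i , fi

  symDiff : ∀ {m} → Sub m → Sub m → Sub m
  symDiff = zipWith _xor_

  sumColsAt-symDiff : ∀ {m n} (col : Fin m → GF2Vec n) A B r →
    sumColsAt col (symDiff A B) r ≡ sumColsAt col A r xor sumColsAt col B r
  sumColsAt-symDiff {m} col A B r = trans
    (⊕F-cong m (λ i → trans (cong (_∧ lookup (col i) r) (lookup-zipWith _xor_ i A B)) (∧-distribʳ-xor _ (lookup A i) (lookup B i))))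
    (⊕F-xor m _ _)

  xor≡false⇒≡ : ∀ a b → a xor b ≡ false → a ≡ b
  xor≡false⇒≡ false false e = refl
  xor≡false⇒≡ true true e = refl

  sumCols-injective : ∀ {m n} (col : Fin m → GF2Vec n) X → Independent col X →
    ∀ X₁ X₂ → X₁ ⊆ X → X₂ ⊆ X → sumCols col X₁ ≡ sumCols col X₂ → X₁ ≡ X₂
  sumCols-injective col X ind X₁ X₂ X₁⊆X X₂⊆X e =
    vec-ext X₁ X₂ λ i → xor≡false⇒≡ _ _ (trans (sym (lookup-zipWith _xor_ i X₁ X₂)) (ind (symDiff X₁ X₂) Δ⊆X Δ-sum i))
    where
    Δ⊆X : symDiff X₁ X₂ ⊆ X
    Δ⊆X i h with lookup X₁ i in e₁ | lookup X₂ i in e₂ | lookup-zipWith _xor_ i X₁ X₂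
    ... | true | _ | _ = X₁⊆X i e₁
    ... | false | true | _ = X₂⊆X i e₂
    ... | false | false | q with () ← trans (sym q) h
    Δ-sum : ∀ r → sumColsAt col (symDiff X₁ X₂) r ≡ false
    Δ-sum r = trans (sumColsAt-symDiff col X₁ X₂ r)
      (trans (cong₂ _xor_ (sym (lookup-sumCols col X₁ r)) (sym (lookup-sumCols col X₂ r)))
      (trans (cong (λ v → lookup v r xor lookup (sumCols col X₂) r) e) (xor-same (lookup (sumCols col X₂) r))))

  InSpan : ∀ {m n} → (Fin m → GF2Vec n) → Sub m → (Fin n → Bool) → Set
  InSpan {m} col Y v = Σ (Sub m) λ Y' → Y' ⊆ Y × (∀ r → sumColsAt col Y' r ≡ v r)

  -- Counting proof: the 2^|X| subset sums of an independent X are distinct and, expanding each column of X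
  -- in terms of Y, all of them are subset sums of Y, of which there are at most 2^|Y|.
  steinitz : ∀ {m n} (col : Fin m → GF2Vec n) X Y → Independent col X →
    (∀ i → lookup X i ≡ true → InSpan col Y (lookup (col i))) → size X ≤ size Y
  steinitz {m} {n} col X Y ind X⊆spanY =
    2^-cancel-≤ _ _ (subst₂ _≤_ (count X) (count Y) (pigeonhole (sums X) (sums Y) sumsX-Unique sumsX⊆sumsY))
    where
    sums : Sub m → List (GF2Vec n)
    sums Z = map (sumCols col) (subsetsOf Z)
    count : ∀ Z → length (sums Z) ≡ 2 ^ size Z
    count Z = trans (length-map (sumCols col) (subsetsOf Z)) (length-subsetsOf Z)
    sumsX-Unique : Unique (sums X)
    sumsX-Unique = Unique-map⁺ (sumCols col) (subsetsOf X) (subsetsOf-Unique X)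
      (λ {x} {y} x∈ y∈ → sumCols-injective col X ind x y (∈-subsetsOf⁻ x X x∈) (∈-subsetsOf⁻ y X y∈))
    expansion : ∀ i → Σ (Sub m) λ Y' → Y' ⊆ Y × (lookup X i ≡ true → ∀ r → sumColsAt col Y' r ≡ lookup (col i) r)
    expansion i with lookup X i in e
    ... | true = let (Y' , Y'⊆Y , sum) = X⊆spanY i e in Y' , Y'⊆Y , λ _ → sum
    ... | false = ∅ , ∅⊆ Y , λ ()
    w : Fin m → Fin m → Bool
    w i j = lookup (proj₁ (expansion i)) j
    rewrite-in-Y : Sub m → Sub m
    rewrite-in-Y X' = tabulate (λ j → ⊕F m (λ i → lookup X' i ∧ w i j))
    rewrite-in-Y-⊆ : ∀ X' → rewrite-in-Y X' ⊆ Y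
    rewrite-in-Y-⊆ X' j e with ⊕F-witness m _ (trans (sym (lookup∘tabulate _ j)) e)
    ... | (i , h) = proj₁ (proj₂ (expansion i)) j (∧-elimʳ (lookup X' i) h)
      where
      ∧-elimʳ : ∀ a {b} → a ∧ b ≡ true → b ≡ true
      ∧-elimʳ true h = h
    rewrite-in-Y-sum : ∀ X' → X' ⊆ X → ∀ r → sumColsAt col (rewrite-in-Y X') r ≡ sumColsAt col X' r
    rewrite-in-Y-sum X' X'⊆X r = begin
        ⊕F m (λ j → lookup (rewrite-in-Y X') j ∧ lookup (col j) r)
      ≡⟨ ⊕F-cong m (λ j → cong (_∧ lookup (col j) r) (lookup∘tabulate _ j)) ⟩
        ⊕F m (λ j → ⊕F m (λ i → lookup X' i ∧ w i j) ∧ lookup (col j) r)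
      ≡⟨ ⊕F-cong m (λ j → trans (sym (⊕F-∧ʳ m _ _)) (⊕F-cong m (λ i → ∧-assoc (lookup X' i) _ _))) ⟩
        ⊕F m (λ j → ⊕F m (λ i → lookup X' i ∧ (w i j ∧ lookup (col j) r)))
      ≡⟨ ⊕F-swap m m _ ⟩
        ⊕F m (λ i → ⊕F m (λ j → lookup X' i ∧ (w i j ∧ lookup (col j) r)))
      ≡⟨ ⊕F-cong m (λ i → ⊕F-∧ˡ m (lookup X' i) _) ⟩
        ⊕F m (λ i → lookup X' i ∧ sumColsAt col (proj₁ (expansion i)) r)
      ≡⟨ ⊕F-cong m (λ i → expand i (lookup X' i) refl) ⟩
        ⊕F m (λ i → lookup X' i ∧ lookup (col i) r) ∎
      where
      open ≡-Reasoning
      expand : ∀ i a → lookup X' i ≡ a → a ∧ sumColsAt col (proj₁ (expansion i)) r ≡ a ∧ lookup (col i) r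
      expand i false e = refl
      expand i true e = proj₂ (proj₂ (expansion i)) (X'⊆X i e) r
    sumsX⊆sumsY : ∀ {v} → v ∈ sums X → v ∈ sums Y
    sumsX⊆sumsY v∈ with ∈-map⁻ (sumCols col) v∈
    ... | (X' , X'∈ , refl) = ≡subst (_∈ sums Y)
      (vec-ext _ _ (λ r → trans (lookup-sumCols col (rewrite-in-Y X') r)
        (trans (rewrite-in-Y-sum X' (∈-subsetsOf⁻ X' X X'∈) r) (sym (lookup-sumCols col X' r)))))
      (∈-map⁺ (sumCols col) (∈-subsetsOf⁺ (rewrite-in-Y X') Y (rewrite-in-Y-⊆ X')))

module MatroidIA where

  open SumsOverFin
  open Rank
  open Steinitz
  open import Data.Bool using (Bool; true; false; _∧_; _xor_; not)
  open import Data.Bool.Properties using (xor-identityʳ)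
  open import Data.Nat using (ℕ; zero; suc; _+_; _≤_; z≤n)
  import Data.Nat.Properties as ℕP
  open import Data.Fin as Fin using (Fin; splitAt)
  open import Data.Fin.Properties using (splitAt-↑ˡ; splitAt-↑ʳ; join-splitAt)
  open import Data.Vec as Vec using (Vec; lookup; replicate; tabulate; _++_)
  open import Data.Vec.Properties using (lookup-replicate; lookup∘tabulate; lookup-++ˡ; lookup-++ʳ; lookup-map)
  open import Data.Product using (_,_)
  open import Data.Sum using (inj₁; inj₂)
  open import Relation.Nullary.Decidable using (⌊_⌋)
  open import Relation.Binary.PropositionalEquality renaming (subst to ≡subst)

  data WView (n : ℕ) : W n → Set where
    isφ : ∀ (v : Fin n) → WView n (φ v)
    isχ : ∀ (v : Fin n) → WView n (χ v)

  wView : ∀ {n} (w : W n) → WView n w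
  wView {n} w = by-half w (splitAt n w) (join-splitAt n n w)
    where
    by-half : ∀ w h → Fin.join n n h ≡ w → WView n w
    by-half _ (inj₁ v) refl = isφ v
    by-half _ (inj₂ v) refl = isχ v

  W-ext : ∀ {n} (T U : Sub (n + n)) → (∀ (v : Fin n) → lookup T (φ v) ≡ lookup U (φ v)) →
    (∀ (v : Fin n) → lookup T (χ v) ≡ lookup U (χ v)) → T ≡ U
  W-ext {n} T U hφ hχ = vec-ext T U λ w → by-view (wView w)
    where
    by-view : ∀ {w} → WView n w → lookup T w ≡ lookup U w
    by-view (isφ v) = hφ v
    by-view (isχ v) = hχ v

  W-empty : ∀ {n} (T : Sub (n + n)) → (∀ (v : Fin n) → lookup T (φ v) ≡ false) →
    (∀ (v : Fin n) → lookup T (χ v) ≡ false) → ∀ w → lookup T w ≡ false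
  W-empty {n} T hφ hχ w with wView {n} w
  ... | isφ v = hφ v
  ... | isχ v = hχ v

  W-⊆ : ∀ {n} (T U : Sub (n + n)) → (∀ (v : Fin n) → lookup T (φ v) ≡ true → lookup U (φ v) ≡ true) →
    (∀ (v : Fin n) → lookup T (χ v) ≡ true → lookup U (χ v) ≡ true) → T ⊆ U
  W-⊆ {n} T U hφ hχ w with wView {n} w
  ... | isφ v = hφ v
  ... | isχ v = hχ v

  lookup-φ : ∀ {n} (P Q : Sub n) v → lookup (P ++ Q) (φ v) ≡ lookup P v
  lookup-φ P Q v = lookup-++ˡ P Q v

  lookup-χ : ∀ {n} (P Q : Sub n) v → lookup (P ++ Q) (χ v) ≡ lookup Q v
  lookup-χ P Q v = lookup-++ʳ P Q v

  colIA-φ : ∀ {n} (G : LoopedGraph n) v r → lookup (colIA G (φ v)) r ≡ ⌊ r Fin.≟ v ⌋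
  colIA-φ {n} G v r with splitAt n (φ {n} v) | splitAt-↑ˡ n v n
  ... | inj₁ .v | refl = lookup∘tabulate _ r

  colIA-χ : ∀ {n} (G : LoopedGraph n) v r → lookup (colIA G (χ v)) r ≡ adj G r v
  colIA-χ {n} G v r with splitAt n (χ {n} v) | splitAt-↑ʳ n n v
  ... | inj₂ .v | refl = lookup∘tabulate _ r

  sumColsAt-IA : ∀ {n} (G : LoopedGraph n) (T : Sub (n + n)) r →
    sumColsAt (colIA G) T r ≡ lookup T (φ r) xor ⊕F n (λ v → lookup T (χ v) ∧ adj G r v)
  sumColsAt-IA {n} G T r = trans (⊕F-++ n n _) (cong₂ _xor_
    (trans (⊕F-cong n (λ v → cong (lookup T (φ v) ∧_) (colIA-φ G v r))) (⊕F-pointʳ n r (λ v → lookup T (φ v))))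
    (⊕F-cong n (λ v → cong (lookup T (χ v) ∧_) (colIA-χ G v r))))

  sumColsAt-IA-++ : ∀ {n} (G : LoopedGraph n) (P Q : Sub n) r →
    sumColsAt (colIA G) (P ++ Q) r ≡ lookup P r xor ⊕F n (λ v → lookup Q v ∧ adj G r v)
  sumColsAt-IA-++ {n} G P Q r = trans (sumColsAt-IA G (P ++ Q) r)
    (cong₂ _xor_ (lookup-φ P Q r) (⊕F-cong n (λ v → cong (_∧ adj G r v) (lookup-χ P Q v))))

  φ-part-vanishes : ∀ {n} (G : LoopedGraph n) (X : Sub (n + n)) → (∀ r → sumColsAt (colIA G) X r ≡ false) →
    (∀ (v : Fin n) → lookup X (χ v) ≡ false) → ∀ (v : Fin n) → lookup X (φ v) ≡ false
  φ-part-vanishes {n} G X sum≡0 noχ v =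
    trans (sym (trans (cong (lookup X (φ v) xor_) (⊕F-false n _ (λ u → cong (_∧ adj G v u) (noχ u))))
                      (xor-identityʳ (lookup X (φ v)))))
          (trans (sym (sumColsAt-IA G X v)) (sum≡0 v))

  size-++ : ∀ {n} (P Q : Sub n) → size (P ++ Q) ≡ size P + size Q
  size-++ {n} P Q = trans (size≡ΣN (P ++ Q)) (trans (ΣN-++ n n _)
    (cong₂ _+_ (trans (ΣN-cong n (λ v → cong ind (lookup-φ P Q v))) (sym (size≡ΣN P)))
               (trans (ΣN-cong n (λ v → cong ind (lookup-χ P Q v))) (sym (size≡ΣN Q)))))

  size-full : ∀ n → size (replicate n true) ≡ n
  size-full n = trans (size≡ΣN (replicate n true)) (trans (ΣN-cong n (λ i → cong ind (lookup-replicate i true))) (ΣN-1 n))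

  size-∅ : ∀ n → size (∅ {n}) ≡ 0
  size-∅ n = trans (size≡ΣN (∅ {n})) (ΣN-0 n _ (λ i → cong ind (lookup-replicate i false)))

  size-mono : ∀ {m} (X T : Sub m) → X ⊆ T → size X ≤ size T
  size-mono {m} X T X⊆T = subst₂ _≤_ (sym (size≡ΣN X)) (sym (size≡ΣN T)) (go m (lookup X) (lookup T) X⊆T)
    where
    ind-mono : ∀ a b → (a ≡ true → b ≡ true) → ind a ≤ ind b
    ind-mono false b f = z≤n
    ind-mono true b f rewrite f refl = ℕP.≤-refl
    go : ∀ k (x t : Fin k → Bool) → (∀ i → x i ≡ true → t i ≡ true) → ΣN k (λ i → ind (x i)) ≤ ΣN k (λ i → ind (t i))
    go zero x t h = z≤n
    go (suc k) x t h = ℕP.+-mono-≤ (ind-mono (x Fin.zero) (t Fin.zero) (h Fin.zero)) (go k _ _ (λ i → h (Fin.suc i)))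

  size-complement : ∀ {n} (S : Sub n) → size (Vec.map not S) + size S ≡ n
  size-complement {n} S = trans (cong₂ _+_ (size≡ΣN (Vec.map not S)) (size≡ΣN S)) (trans (sym (ΣN-+ n _ _))
    (trans (ΣN-cong n (λ i → trans (cong (λ b → ind b + ind (lookup S i)) (lookup-map i not S)) (ind-not (lookup S i)))) (ΣN-1 n)))
    where
    ind-not : ∀ b → ind (not b) + ind b ≡ 1
    ind-not false = refl
    ind-not true = refl

  -- The identity columns form a basis: they are independent and span every column.
  rG-full : ∀ {n} (G : LoopedGraph n) → rG G (replicate _ true) ≡ n
  rG-full {n} G = ℕP.≤-antisym upper lower
    where
    I : Sub (n + n)
    I = replicate n true ++ ∅
    size-I : size I ≡ n
    size-I = trans (size-++ (replicate n true) ∅) (trans (cong₂ _+_ (size-full n) (size-∅ n)) (ℕP.+-identityʳ n))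
    noχ : ∀ X → X ⊆ I → ∀ (v : Fin n) → lookup X (χ v) ≡ false
    noχ X X⊆I v with lookup X (χ v) in e
    ... | false = refl
    ... | true with () ← trans (sym (trans (lookup-χ (replicate n true) ∅ v) (lookup-replicate v false))) (X⊆I (χ v) e)
    spans : ∀ w → InSpan (colIA G) I (lookup (colIA G w))
    spans w = (P ++ ∅) ,
      W-⊆ (P ++ ∅) I (λ v _ → trans (lookup-φ (replicate n true) ∅ v) (lookup-replicate v true))
                     (λ v e → ⊥-true (trans (sym (trans (lookup-χ P ∅ v) (lookup-replicate v false))) e)) ,
      λ r → trans (sumColsAt-IA-++ G P ∅ r)
        (trans (cong₂ _xor_ (lookup∘tabulate (lookup (colIA G w)) r)
                            (⊕F-false n _ (λ v → cong (_∧ adj G r v) (lookup-replicate v false))))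
               (xor-identityʳ (lookup (colIA G w) r)))
      where
      P = tabulate (lookup (colIA G w))
      ⊥-true : ∀ {A : Set} → false ≡ true → A
      ⊥-true ()
    upper : rG G (replicate _ true) ≤ n
    upper = rank-upperBound (colIA G) (replicate _ true) n λ X _ ind →
      ≡subst (size X ≤_) size-I (steinitz (colIA G) X I ind (λ w _ → spans w))
    I-Independent : Independent (colIA G) I
    I-Independent X X⊆I sum≡0 = W-empty X (φ-part-vanishes G X sum≡0 (noχ X X⊆I)) (noχ X X⊆I)
    lower : n ≤ rG G (replicate _ true)
    lower = ≡subst (_≤ rG G (replicate _ true)) size-I
      (rank-lowerBound (colIA G) (replicate (n + n) true) I (λ i _ → lookup-replicate i true) I-Independent)

module TransversalRank where

  open SumsOverFin
  open Rank
  open Steinitz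
  open MatroidIA
  open import Data.Bool using (Bool; true; false; _∧_; _∨_; _xor_; not)
  open import Data.Bool.Properties using (∧-comm; ∧-distribˡ-xor; ∧-distribʳ-xor; xor-same; xor-identityʳ; xor-assoc; T-≡)
  open import Data.Nat using (suc; _+_; _≤_; _<_)
  import Data.Nat.Properties as ℕP
  open import Data.Fin as Fin using (Fin)
  open import Data.Vec as Vec using (Vec; lookup; tabulate; zipWith; _++_)
  open import Data.Vec.Properties using (lookup-replicate; lookup-zipWith; lookup∘tabulate; lookup-map)
  open import Data.Product using (Σ; _×_; _,_; proj₁; proj₂)
  open import Data.Empty using (⊥-elim)
  open import Function using (Equivalence)
  open import Relation.Nullary using (yes; no)
  open import Relation.Nullary.Decidable using (⌊_⌋; toWitness; isYes≗does; dec-true; dec-false)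
  open import Relation.Binary.PropositionalEquality renaming (subst to ≡subst)

  ≟-refl : ∀ {n} (v : Fin n) → ⌊ v Fin.≟ v ⌋ ≡ true
  ≟-refl v = trans (isYes≗does (v Fin.≟ v)) (dec-true (v Fin.≟ v) refl)

  ≟-true : ∀ {n} (u v : Fin n) → ⌊ u Fin.≟ v ⌋ ≡ true → u ≡ v
  ≟-true u v e = toWitness (Equivalence.from T-≡ e)

  ≟-false : ∀ {n} (u v : Fin n) → u ≢ v → ⌊ u Fin.≟ v ⌋ ≡ false
  ≟-false u v u≢v = trans (isYes≗does (u Fin.≟ v)) (dec-false (u Fin.≟ v) u≢v)

  false≢true : ∀ {A : Set} → false ≡ true → A
  false≢true ()

  singleton : ∀ {n} → Fin n → Sub n
  singleton v = tabulate (λ u → ⌊ u Fin.≟ v ⌋)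

  transversal : ∀ {n} → Sub n → Sub (n + n)
  transversal S = Vec.map not S ++ S

  -- The columns of the principal submatrix A(G)[S], padded with zero rows outside S.
  principalCols : ∀ {n} → LoopedGraph n → Sub n → Fin n → GF2Vec n
  principalCols G S v = zipWith _∧_ S (tabulate (λ u → adj G u v))

  sumColsAt-principal : ∀ {n} (G : LoopedGraph n) S Q u →
    sumColsAt (principalCols G S) Q u ≡ lookup S u ∧ ⊕F n (λ v → lookup Q v ∧ adj G u v)
  sumColsAt-principal {n} G S Q u = trans (⊕F-cong n entry) (⊕F-∧ˡ n (lookup S u) _)
    where
    swap : ∀ a b c → a ∧ (b ∧ c) ≡ b ∧ (a ∧ c)
    swap false b c = sym (∧-comm b false)
    swap true b c = refl
    entry : ∀ v → lookup Q v ∧ lookup (principalCols G S v) u ≡ lookup S u ∧ (lookup Q v ∧ adj G u v)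
    entry v = trans (cong (lookup Q v ∧_) (trans (lookup-zipWith _∧_ u S _) (cong (lookup S u ∧_) (lookup∘tabulate _ u))))
                    (swap (lookup Q v) (lookup S u) (adj G u v))

  principalRank≤size : ∀ {n} (G : LoopedGraph n) S → principalRank G S ≤ size S
  principalRank≤size G S = rank-upperBound (principalCols G S) S (size S) λ X X⊆S _ → size-mono X S X⊆S

  module _ {n} (G : LoopedGraph n) (S : Sub n) where

    private
      Sᶜ : Sub n
      Sᶜ = Vec.map not S

      lookup-Sᶜ : ∀ u → lookup Sᶜ u ≡ not (lookup S u)
      lookup-Sᶜ u = lookup-map u not S

      basis : Σ (Sub n) λ B → B ⊆ S × Independent (principalCols G S) B × size B ≡ principalRank G S
      basis = maximalIndependentSubset (principalCols G S) S

      B : Sub n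
      B = proj₁ basis

      B⊆S : B ⊆ S
      B⊆S = proj₁ (proj₂ basis)

      B-Independent : Independent (principalCols G S) B
      B-Independent = proj₁ (proj₂ (proj₂ basis))

      size-B : size B ≡ principalRank G S
      size-B = proj₂ (proj₂ (proj₂ basis))

      -- X = {u_φ | u ∉ S} ∪ {v_χ | v ∈ B} will be shown to be a basis of the transversal.
      X : Sub (n + n)
      X = Sᶜ ++ B

    size-X : size X ≡ size Sᶜ + principalRank G S
    size-X = trans (size-++ Sᶜ B) (cong (size Sᶜ +_) size-B)

    X⊆transversal : X ⊆ transversal S
    X⊆transversal = W-⊆ X (transversal S) (λ v e → trans (lookup-φ Sᶜ S v) (trans (sym (lookup-φ Sᶜ B v)) e))
                                          (λ v e → trans (lookup-χ Sᶜ S v) (B⊆S v (trans (sym (lookup-χ Sᶜ B v)) e)))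

    -- A dependency inside X restricts, on the rows in S, to a dependency among the columns B of A[S].
    X-Independent : Independent (colIA G) X
    X-Independent X' X'⊆X sum≡0 = W-empty X' (φ-part-vanishes G X' sum≡0 noχ) noχ
      where
      Q = tabulate (λ v → lookup X' (χ v))
      lookup-Q : ∀ v → lookup Q v ≡ lookup X' (χ v)
      lookup-Q v = lookup∘tabulate _ v
      Q⊆B : Q ⊆ B
      Q⊆B v e = trans (sym (lookup-χ Sᶜ B v)) (X'⊆X (χ v) (trans (sym (lookup-Q v)) e))
      φ⇒∉S : ∀ u → lookup X' (φ u) ≡ true → lookup S u ≡ false
      φ⇒∉S u e with lookup S u in eS | trans (sym (lookup-φ Sᶜ B u)) (X'⊆X (φ u) e)
      ... | false | _ = refl
      ... | true | h = false≢true (trans (sym (cong not eS)) (trans (sym (lookup-Sᶜ u)) h))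
      Q-sum : ∀ u → sumColsAt (principalCols G S) Q u ≡ false
      Q-sum u = trans (sumColsAt-principal G S Q u) (on-row (lookup S u) refl)
        where
        on-row : ∀ b → lookup S u ≡ b → b ∧ ⊕F n (λ v → lookup Q v ∧ adj G u v) ≡ false
        on-row false _ = refl
        on-row true eS with lookup X' (φ u) in ex
        ... | true = false≢true (trans (sym (φ⇒∉S u ex)) eS)
        ... | false = trans (⊕F-cong n (λ v → cong (_∧ adj G u v) (lookup-Q v)))
                            (trans (sym (cong (_xor ⊕F n (λ v → lookup X' (χ v) ∧ adj G u v)) ex)) (trans (sym (sumColsAt-IA G X' u)) (sum≡0 u)))
      noχ : ∀ (v : Fin n) → lookup X' (χ v) ≡ false
      noχ v = trans (sym (lookup-Q v)) (B-Independent Q Q⊆B Q-sum v)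

    φ-inSpan : ∀ u → lookup S u ≡ false → InSpan (colIA G) X (lookup (colIA G (φ u)))
    φ-inSpan u u∉S = (singleton u ++ ∅) ,
      W-⊆ (singleton u ++ ∅) X
        (λ w e → let w≡u = ≟-true w u (trans (sym (lookup∘tabulate _ w)) (trans (sym (lookup-φ (singleton u) ∅ w)) e)) in
                 trans (lookup-φ Sᶜ B w) (trans (lookup-Sᶜ w) (cong not (trans (cong (lookup S) w≡u) u∉S))))
        (λ w e → false≢true (trans (sym (trans (lookup-χ (singleton u) ∅ w) (lookup-replicate w false))) e)) ,
      λ r → trans (sumColsAt-IA-++ G (singleton u) ∅ r)
        (trans (cong₂ _xor_ (lookup∘tabulate _ r) (⊕F-false n _ (λ w → cong (_∧ adj G r w) (lookup-replicate w false))))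
               (trans (xor-identityʳ ⌊ r Fin.≟ u ⌋) (sym (colIA-φ G u r))))

    χ-inSpan-basis : ∀ v → lookup B v ≡ true → InSpan (colIA G) X (lookup (colIA G (χ v)))
    χ-inSpan-basis v v∈B = (∅ ++ singleton v) ,
      W-⊆ (∅ ++ singleton v) X
        (λ w e → false≢true (trans (sym (trans (lookup-φ ∅ (singleton v) w) (lookup-replicate w false))) e))
        (λ w e → let w≡v = ≟-true w v (trans (sym (lookup∘tabulate _ w)) (trans (sym (lookup-χ ∅ (singleton v) w)) e)) in
                 trans (lookup-χ Sᶜ B w) (trans (cong (lookup B) w≡v) v∈B)) ,
      λ r → trans (sumColsAt-IA-++ G ∅ (singleton v) r)
        (trans (cong₂ _xor_ (lookup-replicate r false)
                            (trans (⊕F-cong n (λ w → cong (_∧ adj G r w) (lookup∘tabulate _ w))) (⊕F-point n v (adj G r))))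
               (sym (colIA-χ G v r)))

    -- For v ∈ S ∖ B the columns B ∪ {v} of A[S] are dependent, since B is a maximal independent set;
    -- solving the dependency for v writes the column of v, on the rows in S, as a sum over some D ⊆ B.
    dependent-on-basis : ∀ v → lookup S v ≡ true → lookup B v ≡ false →
      Σ (Sub n) λ D → D ⊆ B × (∀ u → lookup S u ∧ adj G u v ≡ lookup S u ∧ ⊕F n (λ j → lookup D j ∧ adj G u j))
    dependent-on-basis v v∈S v∉B = D , D⊆B , solved
      where
      B+v = tabulate (λ j → lookup B j ∨ ⌊ j Fin.≟ v ⌋)
      lookup-B+v : ∀ j → lookup B+v j ≡ lookup B j ∨ ⌊ j Fin.≟ v ⌋
      lookup-B+v j = lookup∘tabulate _ j
      B+v⊆S : B+v ⊆ S
      B+v⊆S j e with lookup B j in eB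
      ... | true = B⊆S j eB
      ... | false = trans (cong (lookup S) (≟-true j v (trans (sym (trans (lookup-B+v j) (cong (_∨ _) eB))) e))) v∈S
      size-B+v : size B+v ≡ suc (size B)
      size-B+v = trans (size≡ΣN B+v) (trans (ΣN-cong n (λ j → trans (cong ind (lookup-B+v j)) (ind-∨ j)))
        (trans (ΣN-+ n _ _) (trans (cong₂ _+_ (sym (size≡ΣN B)) (ΣN-point n v)) (ℕP.+-comm (size B) 1))))
        where
        ind-∨ : ∀ j → ind (lookup B j ∨ ⌊ j Fin.≟ v ⌋) ≡ ind (lookup B j) + ind ⌊ j Fin.≟ v ⌋
        ind-∨ j with lookup B j in eB | j Fin.≟ v
        ... | false | _ = refl
        ... | true | no _ = refl
        ... | true | yes refl = false≢true (trans (sym v∉B) eB)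
      B+v-dependent : independent (principalCols G S) B+v ≡ false
      B+v-dependent with independent (principalCols G S) B+v in ie
      ... | false = refl
      ... | true = ⊥-elim (ℕP.<⇒≱ (≡subst (_< size B+v) size-B (≡subst (size B <_) (sym size-B+v) (ℕP.n<1+n (size B))))
                     (rank-lowerBound (principalCols G S) S B+v B+v⊆S (independent⇒Independent (principalCols G S) B+v ie)))
      dependency = and-map-false _ (subsetsOf B+v) B+v-dependent
      C = proj₁ dependency
      C⊆B+v : C ⊆ B+v
      C⊆B+v = ∈-subsetsOf⁻ C B+v (proj₁ (proj₂ dependency))
      nonempty×zero : ∀ a b → not a ∨ not b ≡ false → a ≡ true × b ≡ true
      nonempty×zero true true _ = refl , refl
      C-nonempty = proj₁ (nonempty×zero _ _ (proj₂ (proj₂ dependency)))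
      C-sum : ∀ u → sumColsAt (principalCols G S) C u ≡ false
      C-sum = isZeroV⇒ (principalCols G S) C (proj₂ (nonempty×zero _ _ (proj₂ (proj₂ dependency))))
      v∈C : lookup C v ≡ true
      v∈C with lookup C v in eCv
      ... | true = refl
      ... | false = false≢true (trans (sym (B-Independent C C⊆B C-sum (proj₁ witness))) (proj₂ witness))
        where
        witness = anyB-witness (lookup C) C-nonempty
        C⊆B : C ⊆ B
        C⊆B j e with lookup B j in eBj | j Fin.≟ v | C⊆B+v j e
        ... | true | _ | _ = refl
        ... | false | yes refl | _ = false≢true (trans (sym eCv) e)
        ... | false | no j≢v | h = false≢true (trans (sym (trans (lookup-B+v j) (cong₂ _∨_ eBj (≟-false j v j≢v)))) h)
      D = tabulate (λ j → lookup C j ∧ not ⌊ j Fin.≟ v ⌋)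
      lookup-D : ∀ j → lookup D j ≡ lookup C j ∧ not ⌊ j Fin.≟ v ⌋
      lookup-D j = lookup∘tabulate _ j
      v∉D : lookup D v ≡ false
      v∉D = trans (lookup-D v) (trans (cong (λ b → lookup C v ∧ not b) (≟-refl v)) (∧-comm (lookup C v) false))
      C≡D+v : ∀ j → lookup C j ≡ lookup D j xor ⌊ j Fin.≟ v ⌋
      C≡D+v j with j Fin.≟ v
      ... | yes refl = trans v∈C (sym (cong (_xor true) v∉D))
      ... | no j≢v = sym (trans (xor-identityʳ _) (trans (lookup-D j)
                      (trans (cong (λ b → lookup C j ∧ not b) (≟-false j v j≢v)) (∧-comm (lookup C j) true))))
      D⊆B : D ⊆ B
      D⊆B j e with lookup C j in eC | j Fin.≟ v
      ... | false | _ = false≢true (trans (sym (trans (lookup-D j) (cong (_∧ not ⌊ j Fin.≟ v ⌋) eC))) e)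
      ... | true | yes refl = false≢true (trans (sym v∉D) e)
      ... | true | no j≢v = ∨-false (trans (sym (trans (lookup-B+v j) (cong (lookup B j ∨_) (≟-false j v j≢v)))) (C⊆B+v j eC))
        where
        ∨-false : ∀ {b} → b ∨ false ≡ true → b ≡ true
        ∨-false {true} _ = refl
      solved : ∀ u → lookup S u ∧ adj G u v ≡ lookup S u ∧ ⊕F n (λ j → lookup D j ∧ adj G u j)
      solved u = sym (xor≡false⇒≡ _ _
        (trans (sym (∧-distribˡ-xor (lookup S u) _ (adj G u v)))
        (trans (cong (lookup S u ∧_) (sym C-row)) (trans (sym (sumColsAt-principal G S C u)) (C-sum u)))))
        where
        C-row : ⊕F n (λ j → lookup C j ∧ adj G u j) ≡ ⊕F n (λ j → lookup D j ∧ adj G u j) xor adj G u v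
        C-row = trans (⊕F-cong n (λ j → trans (cong (_∧ adj G u j) (C≡D+v j)) (∧-distribʳ-xor (adj G u j) (lookup D j) _)))
                      (trans (⊕F-xor n (λ j → lookup D j ∧ adj G u j) _) (cong (⊕F n (λ j → lookup D j ∧ adj G u j) xor_) (⊕F-point n v (adj G u))))

    χ-inSpan-dependent : ∀ v → lookup S v ≡ true → lookup B v ≡ false → InSpan (colIA G) X (lookup (colIA G (χ v)))
    χ-inSpan-dependent v v∈S v∉B = (tabulate R ++ D) , Y⊆X , Y-sum
      where
      D = proj₁ (dependent-on-basis v v∈S v∉B)
      D⊆B = proj₁ (proj₂ (dependent-on-basis v v∈S v∉B))
      solved = proj₂ (proj₂ (dependent-on-basis v v∈S v∉B))
      ΣD : Fin n → Bool
      ΣD u = ⊕F n (λ j → lookup D j ∧ adj G u j)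
      R : Fin n → Bool
      R u = adj G u v xor ΣD u
      R⇒∉S : ∀ w → R w ≡ true → lookup S w ≡ false
      R⇒∉S w e with lookup S w in eS
      ... | false = refl
      ... | true = false≢true (sym (trans (sym e) (trans (cong (_xor ΣD w) (trans (cong (_∧ adj G w v) (sym eS))
                     (trans (solved w) (cong (_∧ ΣD w) eS)))) (xor-same (ΣD w)))))
      Y⊆X : (tabulate R ++ D) ⊆ X
      Y⊆X = W-⊆ (tabulate R ++ D) X
        (λ w e → trans (lookup-φ Sᶜ B w) (trans (lookup-Sᶜ w)
          (cong not (R⇒∉S w (trans (sym (lookup∘tabulate R w)) (trans (sym (lookup-φ (tabulate R) D w)) e))))))
        (λ w e → trans (lookup-χ Sᶜ B w) (D⊆B w (trans (sym (lookup-χ (tabulate R) D w)) e)))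
      Y-sum : ∀ r → sumColsAt (colIA G) (tabulate R ++ D) r ≡ lookup (colIA G (χ v)) r
      Y-sum r = trans (sumColsAt-IA-++ G (tabulate R) D r)
        (trans (cong (_xor ΣD r) (lookup∘tabulate R r))
        (trans (xor-assoc (adj G r v) (ΣD r) (ΣD r))
        (trans (cong (adj G r v xor_) (xor-same (ΣD r))) (trans (xor-identityʳ _) (sym (colIA-χ G v r))))))

    rG-transversal : rG G (transversal S) ≡ size Sᶜ + principalRank G S
    rG-transversal = ℕP.≤-antisym upper lower
      where
      lower : size Sᶜ + principalRank G S ≤ rG G (transversal S)
      lower = ≡subst (_≤ rG G (transversal S)) size-X (rank-lowerBound (colIA G) (transversal S) X X⊆transversal X-Independent)
      inSpan : ∀ w → lookup (transversal S) w ≡ true → InSpan (colIA G) X (lookup (colIA G w))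
      inSpan w e with wView {n} w
      ... | isφ u = φ-inSpan u (not-true (trans (sym (lookup-Sᶜ u)) (trans (sym (lookup-φ Sᶜ S u)) e)))
        where
        not-true : ∀ {b} → not b ≡ true → b ≡ false
        not-true {false} _ = refl
      ... | isχ v with lookup B v in eB
      ... | true = χ-inSpan-basis v eB
      ... | false = χ-inSpan-dependent v (trans (sym (lookup-χ Sᶜ S v)) e) eB
      upper : rG G (transversal S) ≤ size Sᶜ + principalRank G S
      upper = rank-upperBound (colIA G) (transversal S) _ λ Y Y⊆T ind →
        ≡subst (size Y ≤_) size-X (steinitz (colIA G) Y X ind λ w e → inSpan w (Y⊆T w e))

module Monomials where

  open SumsOverFin
  open Steinitz using (vec-ext)
  open PolynomialRing using (_⊕_)
  open import Data.Bool using (Bool; true; false; not; if_then_else_)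
  open import Data.Nat as ℕ using (ℕ; zero; suc; _+_)
  import Data.Nat.Properties as ℕP
  open import Data.Integer using (ℤ; 1ℤ; _*_)
  open import Data.Fin as Fin using (Fin; zero; suc; _↑ˡ_; _↑ʳ_; splitAt)
  open import Data.Fin.Properties using (splitAt-↑ˡ; splitAt-↑ʳ; join-splitAt; ↑ˡ-injective; ↑ʳ-injective; suc-injective)
  open import Data.Vec using (Vec; _∷_; lookup; replicate; tabulate; _++_)
  open import Data.Vec.Properties using (lookup-replicate; lookup-zipWith; lookup∘tabulate; lookup-++ˡ; lookup-++ʳ)
  open import Data.List as List using (List; []; _∷_; map; foldr; filterᵇ)
  open import Data.Product using (_,_)
  open import Data.Sum using (inj₁; inj₂)
  open import Data.Empty using (⊥-elim)
  open import Relation.Nullary using (yes; no)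
  open import Relation.Nullary.Decidable using (⌊_⌋)
  open import Relation.Binary.PropositionalEquality renaming (subst to ≡subst)

  kron : ∀ {m} → Fin m → Fin m → ℕ
  kron i j = if ⌊ i Fin.≟ j ⌋ then 1 else 0

  kron-injective : ∀ {m k} (f : Fin m → Fin k) → (∀ {i j} → f i ≡ f j → i ≡ j) → ∀ i j → kron (f i) (f j) ≡ kron i j
  kron-injective f f-inj i j with f i Fin.≟ f j | i Fin.≟ j
  ... | yes _ | yes _ = refl
  ... | no _ | no _ = refl
  ... | yes e | no ne = ⊥-elim (ne (f-inj e))
  ... | no ne | yes refl = ⊥-elim (ne refl)

  kron-≢ : ∀ {k} (i j : Fin k) → i ≢ j → kron i j ≡ 0
  kron-≢ i j i≢j with i Fin.≟ j
  ... | yes e = ⊥-elim (i≢j e)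
  ... | no _ = refl

  kron-refl : ∀ {k} (i : Fin k) → kron i i ≡ 1
  kron-refl i with i Fin.≟ i
  ... | yes _ = refl
  ... | no ne = ⊥-elim (ne refl)

  ↑ˡ≢↑ʳ : ∀ {a b} (i : Fin a) (j : Fin b) → (i ↑ˡ b) ≢ (a ↑ʳ j)
  ↑ˡ≢↑ʳ {a} {b} i j e with () ← trans (sym (splitAt-↑ˡ a i b)) (trans (cong (splitAt a) e) (splitAt-↑ʳ a b j))

  unitM : ∀ {k} → Fin k → Mono k
  unitM i = tabulate (kron i)

  lookup-unitM : ∀ {k} (i j : Fin k) → lookup (unitM i) j ≡ kron i j
  lookup-unitM i j = lookup∘tabulate (kron i) j

  multiplicity : ∀ {m} → List (Fin m) → Fin m → ℕ
  multiplicity l x = foldr (λ w acc → kron w x + acc) 0 l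

  multiplicity-filter-tabulate : ∀ {A : Set} k (f : Fin k → A) (p : A → Bool) (g : A → ℕ) →
    foldr (λ w acc → g w + acc) 0 (filterᵇ p (List.tabulate f)) ≡ ΣN k (λ i → if p (f i) then g (f i) else 0)
  multiplicity-filter-tabulate zero f p g = refl
  multiplicity-filter-tabulate (suc k) f p g with p (f zero)
  ... | true = cong (g (f zero) +_) (multiplicity-filter-tabulate k (λ i → f (suc i)) p g)
  ... | false = multiplicity-filter-tabulate k (λ i → f (suc i)) p g

  ΣN-kron : ∀ m (b : Fin m → Bool) (x : Fin m) → ΣN m (λ i → if b i then kron i x else 0) ≡ ind (b x)
  ΣN-kron (suc m) b zero with b zero
  ... | true = cong suc (ΣN-0 m _ (λ i → if-0 (b (suc i))))
    where
    if-0 : ∀ c → (if c then 0 else 0) ≡ 0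
    if-0 true = refl
    if-0 false = refl
  ... | false = ΣN-0 m _ (λ i → if-0 (b (suc i)))
    where
    if-0 : ∀ c → (if c then 0 else 0) ≡ 0
    if-0 true = refl
    if-0 false = refl
  ΣN-kron (suc m) b (suc x) = trans
    (cong₂ _+_ (head-0 (b zero)) (ΣN-cong m (λ i → cong (λ k → if b (suc i) then k else 0) (kron-injective suc suc-injective i x))))
    (ΣN-kron m (λ i → b (suc i)) x)
    where
    head-0 : ∀ c → (if c then kron (zero {m}) (suc x) else 0) ≡ 0
    head-0 true = refl
    head-0 false = refl

  multiplicity-elems : ∀ {m} (T : Sub m) x → multiplicity (elems T) x ≡ ind (lookup T x)
  multiplicity-elems {m} T x = trans (multiplicity-filter-tabulate m (λ i → i) (lookup T) (λ w → kron w x)) (ΣN-kron m (lookup T) x)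

  multiplicity-nonElems : ∀ {m} (T : Sub m) x → multiplicity (nonElems T) x ≡ ind (not (lookup T x))
  multiplicity-nonElems {m} T x =
    trans (multiplicity-filter-tabulate m (λ i → i) (λ i → not (lookup T i)) (λ w → kron w x)) (ΣN-kron m (λ i → not (lookup T i)) x)

  module MonomialsOf (n : ℕ) where

    iS iZ : Fin (NV n)
    iS = sV {n}
    iZ = zV {n}

    iA iB : W n → Fin (NV n)
    iA = aV {n}
    iB = bV {n}

    0̂ : W n → ℕ
    0̂ _ = 0

    mono : ℕ → ℕ → (W n → ℕ) → (W n → ℕ) → Mono (NV n)
    mono σ ζ α β = σ ∷ ζ ∷ (tabulate α ++ tabulate β)

    lookup-mono-a : ∀ σ ζ α β (w : W n) → lookup (mono σ ζ α β) (iA w) ≡ α w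
    lookup-mono-a σ ζ α β w = trans (lookup-++ˡ (tabulate α) (tabulate β) w) (lookup∘tabulate α w)

    lookup-mono-b : ∀ σ ζ α β (w : W n) → lookup (mono σ ζ α β) (iB w) ≡ β w
    lookup-mono-b σ ζ α β w = trans (lookup-++ʳ (tabulate α) (tabulate β) w) (lookup∘tabulate β w)

    data VarView : Fin (NV n) → Set where
      isS : VarView iS
      isZ : VarView iZ
      isA : ∀ w → VarView (iA w)
      isB : ∀ w → VarView (iB w)

    varView : ∀ (j : Fin (NV n)) → VarView j
    varView zero = isS
    varView (suc zero) = isZ
    varView (suc (suc k)) = by-half k (splitAt (n + n) k) (join-splitAt (n + n) (n + n) k)
      where
      by-half : ∀ k h → Fin.join (n + n) (n + n) h ≡ k → VarView (suc (suc k))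
      by-half _ (inj₁ w) refl = isA w
      by-half _ (inj₂ w) refl = isB w

    mono-ext : ∀ (μ ν : Mono (NV n)) → lookup μ iS ≡ lookup ν iS → lookup μ iZ ≡ lookup ν iZ →
      (∀ w → lookup μ (iA w) ≡ lookup ν (iA w)) → (∀ w → lookup μ (iB w) ≡ lookup ν (iB w)) → μ ≡ ν
    mono-ext μ ν hs hz ha hb = vec-ext μ ν λ j → by-view (varView j)
      where
      by-view : ∀ {j} → VarView j → lookup μ j ≡ lookup ν j
      by-view isS = hs
      by-view isZ = hz
      by-view (isA w) = ha w
      by-view (isB w) = hb w

    mono-⊕ : ∀ σ ζ α β σ' ζ' α' β' →
      mono σ ζ α β ⊕ mono σ' ζ' α' β' ≡ mono (σ + σ') (ζ + ζ') (λ w → α w + α' w) (λ w → β w + β' w)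
    mono-⊕ σ ζ α β σ' ζ' α' β' = mono-ext _ _ refl refl
      (λ w → trans (lookup-zipWith _+_ (iA w) (mono σ ζ α β) (mono σ' ζ' α' β'))
        (trans (cong₂ _+_ (lookup-mono-a σ ζ α β w) (lookup-mono-a σ' ζ' α' β' w)) (sym (lookup-mono-a (σ + σ') (ζ + ζ') _ _ w))))
      (λ w → trans (lookup-zipWith _+_ (iB w) (mono σ ζ α β) (mono σ' ζ' α' β'))
        (trans (cong₂ _+_ (lookup-mono-b σ ζ α β w) (lookup-mono-b σ' ζ' α' β' w)) (sym (lookup-mono-b (σ + σ') (ζ + ζ') _ _ w))))

    mono-cong : ∀ {σ σ' ζ ζ'} {α α' β β' : W n → ℕ} → σ ≡ σ' → ζ ≡ ζ' →
      (∀ w → α w ≡ α' w) → (∀ w → β w ≡ β' w) → mono σ ζ α β ≡ mono σ' ζ' α' β'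
    mono-cong {σ} {_} {ζ} {_} {α} {α'} {β} {β'} refl refl ha hb = mono-ext _ _ refl refl
      (λ w → trans (lookup-mono-a σ ζ α β w) (trans (ha w) (sym (lookup-mono-a σ ζ α' β' w))))
      (λ w → trans (lookup-mono-b σ ζ α β w) (trans (hb w) (sym (lookup-mono-b σ ζ α' β' w))))

    mono-0 : replicate (NV n) 0 ≡ mono 0 0 0̂ 0̂
    mono-0 = mono-ext _ _ refl refl (λ w → trans (lookup-replicate (iA w) 0) (sym (lookup-mono-a 0 0 0̂ 0̂ w)))
                                    (λ w → trans (lookup-replicate (iB w) 0) (sym (lookup-mono-b 0 0 0̂ 0̂ w)))

    iA-injective : ∀ {w w' : W n} → iA w ≡ iA w' → w ≡ w'
    iA-injective e = ↑ˡ-injective (n + n) _ _ (suc-injective (suc-injective e))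

    iB-injective : ∀ {w w' : W n} → iB w ≡ iB w' → w ≡ w'
    iB-injective e = ↑ʳ-injective (n + n) _ _ (suc-injective (suc-injective e))

    iA≢iB : ∀ (w w' : W n) → iA w ≢ iB w'
    iA≢iB w w' e = ↑ˡ≢↑ʳ w w' (suc-injective (suc-injective e))

    unit-a : ∀ (w : W n) → unitM (iA w) ≡ mono 0 0 (kron w) 0̂
    unit-a w = mono-ext _ _ (lookup-unitM (iA w) iS) (lookup-unitM (iA w) iZ)
      (λ x → trans (lookup-unitM (iA w) (iA x)) (trans (kron-injective iA iA-injective w x) (sym (lookup-mono-a 0 0 (kron w) 0̂ x))))
      (λ x → trans (lookup-unitM (iA w) (iB x)) (trans (kron-≢ (iA w) (iB x) (iA≢iB w x)) (sym (lookup-mono-b 0 0 (kron w) 0̂ x))))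

    unit-b : ∀ (w : W n) → unitM (iB w) ≡ mono 0 0 0̂ (kron w)
    unit-b w = mono-ext _ _ (lookup-unitM (iB w) iS) (lookup-unitM (iB w) iZ)
      (λ x → trans (lookup-unitM (iB w) (iA x)) (trans (kron-≢ (iB w) (iA x) (λ e → iA≢iB x w (sym e))) (sym (lookup-mono-a 0 0 0̂ (kron w) x))))
      (λ x → trans (lookup-unitM (iB w) (iB x)) (trans (kron-injective iB iB-injective w x) (sym (lookup-mono-b 0 0 0̂ (kron w) x))))

    unit-s : unitM iS ≡ mono 1 0 0̂ 0̂
    unit-s = mono-ext _ _ (lookup-unitM iS iS) (lookup-unitM iS iZ)
      (λ x → trans (lookup-unitM iS (iA x)) (sym (lookup-mono-a 1 0 0̂ 0̂ x)))
      (λ x → trans (lookup-unitM iS (iB x)) (sym (lookup-mono-b 1 0 0̂ 0̂ x)))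

    unit-z : unitM iZ ≡ mono 0 1 0̂ 0̂
    unit-z = mono-ext _ _ (lookup-unitM iZ iS) (lookup-unitM iZ iZ)
      (λ x → trans (lookup-unitM iZ (iA x)) (sym (lookup-mono-a 0 1 0̂ 0̂ x)))
      (λ x → trans (lookup-unitM iZ (iB x)) (sym (lookup-mono-b 0 1 0̂ 0̂ x)))

    -- Each product below is a single term with coefficient 1, so these are equalities of lists, not just ≈P.

    monomial : Mono (NV n) → PP n
    monomial μ = (1ℤ , μ) ∷ []

    prod-a : ∀ (l : List (W n)) → prodP (map (a {n}) l) ≡ monomial (mono 0 0 (multiplicity l) 0̂)
    prod-a [] = cong monomial mono-0
    prod-a (w ∷ l) rewrite prod-a l =
      cong monomial (trans (cong (_⊕ mono 0 0 (multiplicity l) 0̂) (unit-a w)) (mono-⊕ 0 0 (kron w) 0̂ 0 0 (multiplicity l) 0̂))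

    prod-b : ∀ (l : List (W n)) → prodP (map (b {n}) l) ≡ monomial (mono 0 0 0̂ (multiplicity l))
    prod-b [] = cong monomial mono-0
    prod-b (w ∷ l) rewrite prod-b l =
      cong monomial (trans (cong (_⊕ mono 0 0 0̂ (multiplicity l)) (unit-b w)) (mono-⊕ 0 0 0̂ (kron w) 0 0 0̂ (multiplicity l)))

    aExp bExp : Sub (n + n) → W n → ℕ
    aExp T w = ind (lookup T w)
    bExp T w = ind (not (lookup T w))

    monoT≡ : ∀ (T : Sub (n + n)) → monoT {n} T ≡ monomial (mono 0 0 (aExp T) (bExp T))
    monoT≡ T rewrite prod-a (elems T) | prod-b (nonElems T) =
      cong monomial (trans (mono-⊕ 0 0 (multiplicity (elems T)) 0̂ 0 0 0̂ (multiplicity (nonElems T)))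
        (mono-cong refl refl (λ w → trans (ℕP.+-identityʳ _) (multiplicity-elems T w)) (λ w → multiplicity-nonElems T w)))

    s^≡ : ∀ k → s {n} ^P k ≡ monomial (mono k 0 0̂ 0̂)
    s^≡ zero = cong monomial mono-0
    s^≡ (suc k) rewrite s^≡ k = cong monomial (trans (cong (_⊕ mono k 0 0̂ 0̂) unit-s) (mono-⊕ 1 0 0̂ 0̂ k 0 0̂ 0̂))

    z^≡ : ∀ k → z {n} ^P k ≡ monomial (mono 0 k 0̂ 0̂)
    z^≡ zero = cong monomial mono-0
    z^≡ (suc k) rewrite z^≡ k = cong monomial (trans (cong (_⊕ mono 0 k 0̂ 0̂) unit-z) (mono-⊕ 0 1 0̂ 0̂ 0 k 0̂ 0̂))

    sz^≡ : ∀ k → (s {n} *P z {n}) ^P k ≡ monomial (mono k k 0̂ 0̂)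
    sz^≡ zero = cong monomial mono-0
    sz^≡ (suc k) rewrite sz^≡ k = cong monomial
      (trans (cong₂ (λ u v → (u ⊕ v) ⊕ mono k k 0̂ 0̂) unit-s unit-z)
        (trans (cong (_⊕ mono k k 0̂ 0̂) (mono-⊕ 1 0 0̂ 0̂ 0 1 0̂ 0̂)) (mono-⊕ 1 1 _ _ k k 0̂ 0̂)))

    tauTerm≡ : ∀ (T : Sub (n + n)) p q → monoT {n} T *P (s {n} ^P p) *P (z {n} ^P q) ≡ monomial (mono p q (aExp T) (bExp T))
    tauTerm≡ T p q = trans (cong₂ _*P_ (cong₂ _*P_ (monoT≡ T) (s^≡ p)) (z^≡ q)) (cong monomial
      (trans (cong (_⊕ mono 0 q 0̂ 0̂) (mono-⊕ 0 0 (aExp T) (bExp T) p 0 0̂ 0̂)) (trans (mono-⊕ p 0 _ _ 0 q 0̂ 0̂)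
        (mono-cong (ℕP.+-identityʳ p) refl (λ w → trans (ℕP.+-identityʳ _) (ℕP.+-identityʳ _))
                                           (λ w → trans (ℕP.+-identityʳ _) (ℕP.+-identityʳ _))))))

    rhsTerm≡ : ∀ (T : Sub (n + n)) k → monoT {n} T *P ((s {n} *P z {n}) ^P k) ≡ monomial (mono k k (aExp T) (bExp T))
    rhsTerm≡ T k = trans (cong₂ _*P_ (monoT≡ T) (sz^≡ k)) (cong monomial
      (trans (mono-⊕ 0 0 (aExp T) (bExp T) k k 0̂ 0̂) (mono-cong refl refl (λ w → ℕP.+-identityʳ _) (λ w → ℕP.+-identityʳ _))))

    generatorA≡ : ∀ (c : ℤ) (T : Sub (n + n)) k →
      constP c *P monoT {n} T *P ((s {n} *P z {n}) ^P k) ≡ (c * 1ℤ * 1ℤ , mono k k (aExp T) (bExp T)) ∷ []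
    generatorA≡ c T k = trans (cong₂ _*P_ (cong (constP c *P_) (monoT≡ T)) (sz^≡ k)) (cong (λ μ → (c * 1ℤ * 1ℤ , μ) ∷ [])
      (trans (cong (λ u → (u ⊕ mono 0 0 (aExp T) (bExp T)) ⊕ mono k k 0̂ 0̂) mono-0)
        (trans (cong (_⊕ mono k k 0̂ 0̂) (mono-⊕ 0 0 0̂ 0̂ 0 0 (aExp T) (bExp T)))
          (trans (mono-⊕ 0 0 _ _ k k 0̂ 0̂) (mono-cong refl refl (λ w → ℕP.+-identityʳ _) (λ w → ℕP.+-identityʳ _))))))

module PolynomialSums where

  open PolynomialRing using (_≋_; polynomialRing)
  open SumsOverFin using (ΣN)
  open import Algebra.Bundles using (CommutativeRing)
  open import Data.Bool using (Bool; true; false; not; if_then_else_)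
  open import Data.Nat as ℕ using (ℕ; zero; suc)
  open import Data.Fin as Fin using (Fin; zero; suc)
  open import Data.Empty using (⊥-elim)
  open import Relation.Nullary using (Dec; yes; no)
  open import Relation.Nullary.Decidable using (⌊_⌋)
  open import Data.List.Relation.Unary.Unique.Propositional using (Unique)
  open import Data.List.Relation.Unary.AllPairs using (_∷_)
  import Data.List.Relation.Unary.All as All
  open import Data.List as List using (List; []; _∷_; map; foldr; filterᵇ; allFin)
  open import Data.List.Properties using (map-tabulate)
  open import Data.List.Membership.Propositional using (_∈_)
  open import Data.List.Relation.Unary.Any using (here; there)
  open import Relation.Binary.PropositionalEquality as ≡ using (_≡_; _≢_; refl; cong)

  module SumsIn (k : ℕ) where

    open CommutativeRing (polynomialRing k) public using (setoid) renaming
      ( refl to ≋-refl; sym to ≋-sym; trans to ≋-trans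
      ; +-cong to +P-cong; *-cong to *P-cong; -‿cong to -P-cong
      ; +-comm to +P-comm; +-assoc to +P-assoc; *-comm to *P-comm; *-assoc to *P-assoc
      ; +-identityˡ to +P-identityˡ; +-identityʳ to +P-identityʳ; *-identityˡ to *P-identityˡ; *-identityʳ to *P-identityʳ
      ; -‿inverseʳ to -P-inverseʳ; distribˡ to *P-distribˡ; distribʳ to *P-distribʳ
      ; zeroˡ to *P-zeroˡ; zeroʳ to *P-zeroʳ; +-commutativeSemigroup to +P-commutativeSemigroup )
    open import Algebra.Properties.Ring (CommutativeRing.ring (polynomialRing k)) public
      using (-‿distribˡ-*; -‿+-comm; -0#≈0#)
    open import Algebra.Properties.CommutativeSemigroup +P-commutativeSemigroup using (interchange)
    open import Relation.Binary.Reasoning.Setoid setoid public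

    P : Set
    P = Poly k

    ≡⇒≋ : ∀ {p q : P} → p ≡ q → p ≋ q
    ≡⇒≋ refl = ≋-refl

    ΣP : ∀ {A : Set} → (A → P) → List A → P
    ΣP f L = sumP (map f L)

    ΣP-cong : ∀ {A : Set} {f g : A → P} (L : List A) → (∀ x → f x ≋ g x) → ΣP f L ≋ ΣP g L
    ΣP-cong [] h = ≋-refl
    ΣP-cong (x ∷ L) h = +P-cong (h x) (ΣP-cong L h)

    ΣP-+ : ∀ {A : Set} (f g : A → P) (L : List A) → ΣP (λ x → f x +P g x) L ≋ ΣP f L +P ΣP g L
    ΣP-+ f g [] = ≋-sym (+P-identityˡ 0P)
    ΣP-+ f g (x ∷ L) = ≋-trans (+P-cong (≋-refl {f x +P g x}) (ΣP-+ f g L)) (interchange (f x) (g x) (ΣP f L) (ΣP g L))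

    ΣP-0 : ∀ {A : Set} (f : A → P) (L : List A) → (∀ x → x ∈ L → f x ≋ 0P) → ΣP f L ≋ 0P
    ΣP-0 f [] h = ≋-refl
    ΣP-0 f (x ∷ L) h = ≋-trans (+P-cong (h x (here refl)) (ΣP-0 f L (λ y y∈ → h y (there y∈)))) (+P-identityˡ 0P)

    ΣP-neg : ∀ {A : Set} (f : A → P) (L : List A) → -P ΣP f L ≋ ΣP (λ x → -P f x) L
    ΣP-neg f [] = -0#≈0#
    ΣP-neg f (x ∷ L) = ≋-trans (≋-sym (-‿+-comm (f x) (ΣP f L))) (+P-cong (≋-refl { -P f x}) (ΣP-neg f L))

    ΣP-*ʳ : ∀ {A : Set} (p : P) (f : A → P) (L : List A) → ΣP f L *P p ≋ ΣP (λ x → f x *P p) L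
    ΣP-*ʳ p f [] = *P-zeroˡ p
    ΣP-*ʳ p f (x ∷ L) = ≋-trans (*P-distribʳ p (f x) (ΣP f L)) (+P-cong (≋-refl {f x *P p}) (ΣP-*ʳ p f L))

    ΣP-swap : ∀ {A B : Set} (F : A → B → P) (L₁ : List A) (L₂ : List B) →
      ΣP (λ x → ΣP (F x) L₂) L₁ ≋ ΣP (λ y → ΣP (λ x → F x y) L₁) L₂
    ΣP-swap F [] L₂ = ≋-sym (ΣP-0 _ L₂ (λ _ _ → ≋-refl))
    ΣP-swap F (x ∷ L₁) L₂ =
      ≋-trans (+P-cong (≋-refl {ΣP (F x) L₂}) (ΣP-swap F L₁ L₂)) (≋-sym (ΣP-+ (F x) (λ y → ΣP (λ x → F x y) L₁) L₂))

    infixr 9 ⟪_⟫_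
    ⟪_⟫_ : Bool → P → P
    ⟪ b ⟫ p = if b then p else 0P

    ΣP-filter : ∀ {A : Set} (f : A → P) (p : A → Bool) (L : List A) → ΣP f (filterᵇ p L) ≋ ΣP (λ x → ⟪ p x ⟫ f x) L
    ΣP-filter f p [] = ≋-refl
    ΣP-filter f p (x ∷ L) with p x
    ... | true = +P-cong (≋-refl {f x}) (ΣP-filter f p L)
    ... | false = ≋-trans (ΣP-filter f p L) (≋-sym (+P-identityˡ _))

    ΣP-split : ∀ {A : Set} (f : A → P) (p : A → Bool) (L : List A) →
      ΣP f L ≋ ΣP (λ x → ⟪ p x ⟫ f x) L +P ΣP (λ x → ⟪ not (p x) ⟫ f x) L
    ΣP-split f p L = ≋-trans (ΣP-cong L (λ x → by-case x (p x))) (ΣP-+ _ _ L)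
      where
      by-case : ∀ x b → f x ≋ ⟪ b ⟫ f x +P ⟪ not b ⟫ f x
      by-case x true = ≋-sym (+P-identityʳ (f x))
      by-case x false = ≋-sym (+P-identityˡ (f x))

    ΣP-point : ∀ {A : Set} (_≟_ : (x y : A) → Dec (x ≡ y)) (q : P) (L : List A) x →
      Unique L → x ∈ L → ΣP (λ y → ⟪ ⌊ y ≟ x ⌋ ⟫ q) L ≋ q
    ΣP-point _≟_ q (y ∷ L) .y (y∉L ∷ L!) (here refl) with y ≟ y
    ... | no y≢y = ⊥-elim (y≢y refl)
    ... | yes _ = ≋-trans (+P-cong (≋-refl {q}) (ΣP-0 _ L rest-0)) (+P-identityʳ q)
      where
      rest-0 : ∀ z → z ∈ L → ⟪ ⌊ z ≟ y ⌋ ⟫ q ≋ 0P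
      rest-0 z z∈ with z ≟ y
      ... | yes refl = ⊥-elim (All.lookup y∉L z∈ refl)
      ... | no _ = ≋-refl
    ΣP-point _≟_ q (y ∷ L) x (y∉L ∷ L!) (there x∈) with y ≟ x
    ... | yes refl = ⊥-elim (All.lookup y∉L x∈ refl)
    ... | no _ = ≋-trans (ΣP-point _≟_ q L x L! x∈) (≋-sym (+P-identityˡ q))

    ΣP-tabulate-suc : ∀ m (f : Fin (suc m) → P) → ΣP f (List.tabulate {n = m} suc) ≡ ΣP (λ i → f (suc i)) (allFin m)
    ΣP-tabulate-suc m f = cong sumP (≡.trans (map-tabulate {n = m} suc f) (≡.sym (map-tabulate {n = m} (λ i → i) (λ i → f (suc i)))))

    ΠF : ∀ m → (Fin m → P) → P
    ΠF zero f = 1P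
    ΠF (suc m) f = f zero *P ΠF m (λ i → f (suc i))

    ΠF-cong : ∀ m {f g : Fin m → P} → (∀ i → f i ≋ g i) → ΠF m f ≋ ΠF m g
    ΠF-cong zero h = ≋-refl
    ΠF-cong (suc m) h = *P-cong (h zero) (ΠF-cong m (λ i → h (suc i)))

    ΠF-1 : ∀ m (f : Fin m → P) → (∀ i → f i ≋ 1P) → ΠF m f ≋ 1P
    ΠF-1 zero f h = ≋-refl
    ΠF-1 (suc m) f h = ≋-trans (*P-cong (h zero) (ΠF-1 m _ (λ i → h (suc i)))) (*P-identityˡ 1P)

    ΠF-++ : ∀ a b (f : Fin (a ℕ.+ b) → P) → ΠF (a ℕ.+ b) f ≋ ΠF a (λ i → f (i Fin.↑ˡ b)) *P ΠF b (λ j → f (a Fin.↑ʳ j))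
    ΠF-++ zero b f = ≋-sym (*P-identityˡ _)
    ΠF-++ (suc a) b f = ≋-trans (*P-cong (≋-refl {f zero}) (ΠF-++ a b (λ i → f (suc i)))) (≋-sym (*P-assoc (f zero) _ _))

    prodP-allFin : ∀ m (f : Fin m → P) → prodP (map f (allFin m)) ≡ ΠF m f
    prodP-allFin m f = ≡.trans (cong prodP (map-tabulate {n = m} (λ i → i) f)) (go m f)
      where
      go : ∀ m (f : Fin m → P) → foldr _*P_ 1P (List.tabulate f) ≡ ΠF m f
      go zero f = refl
      go (suc m) f = cong (f zero *P_) (go m (λ i → f (suc i)))

    ^P-+ : ∀ (p : P) a b → p ^P (a ℕ.+ b) ≋ p ^P a *P p ^P b
    ^P-+ p zero b = ≋-sym (*P-identityˡ _)
    ^P-+ p (suc a) b = ≋-trans (*P-cong (≋-refl {p}) (^P-+ p a b)) (≋-sym (*P-assoc p _ _))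

    1P-^P : ∀ e → 1P ^P e ≋ 1P
    1P-^P zero = ≋-refl
    1P-^P (suc e) = ≋-trans (*P-cong (≋-refl {1P}) (1P-^P e)) (*P-identityˡ 1P)

    ΠF-^P : ∀ m (p : P) (e : Fin m → ℕ) → ΠF m (λ i → p ^P e i) ≋ p ^P ΣN m e
    ΠF-^P zero p e = ≋-refl
    ΠF-^P (suc m) p e = ≋-trans (*P-cong (≋-refl {p ^P e zero}) (ΠF-^P m p (λ i → e (suc i)))) (≋-sym (^P-+ p (e zero) _))

module Injectivity where

  open PolynomialRing
  open SumsOverFin using (ind; allB⇒)
  open Monomials
  open import Data.Bool using (true; false; _xor_; not)
  open import Data.Nat as ℕ using (ℕ; _+_)
  import Data.Nat.Properties as ℕP
  open import Data.Integer using (ℤ; +_; _*_; -_) renaming (_+_ to _+ℤ_)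
  import Data.Integer.Properties as ℤP
  open import Data.Fin using (Fin)
  open import Data.Fin.Properties using (all?)
  open import Data.Vec using (lookup)
  open import Data.Vec.Properties using (lookup-zipWith)
  open import Data.List using (List; []; _∷_; map; allFin)
  open import Data.List.Membership.Propositional using (_∈_)
  open import Data.List.Relation.Unary.Any using (here; there)
  import Data.List.Relation.Unary.All as All
  open import Data.Product using (_×_; _,_; proj₁; proj₂)
  open import Data.Sum using (_⊎_; inj₁; inj₂)
  open import Data.Empty using (⊥; ⊥-elim)
  open import Relation.Nullary using (¬_; yes; no; Dec)
  open import Relation.Nullary.Decidable using (_×-dec_; _⊎-dec_)
  open import Relation.Binary.PropositionalEquality renaming (subst to ≡subst)

  ev-sumP-0 : ∀ {k} {A : Set} (h : Mono k → ℤ) (f : A → Poly k) (L : List A) →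
    (∀ {x} → x ∈ L → ev h (f x) ≡ + 0) → ev h (sumP (map f L)) ≡ + 0
  ev-sumP-0 h f [] H = refl
  ev-sumP-0 h f (x ∷ L) H = trans (ev-++ h (f x) (sumP (map f L))) (cong₂ _+ℤ_ (H (here refl)) (ev-sumP-0 h f L (λ x∈ → H (there x∈))))

  δ-≢ : ∀ {k} (m μ : Mono k) → μ ≢ m → δ m μ ≡ + 0
  δ-≢ m μ μ≢m with μ ≟M m
  ... | yes e = ⊥-elim (μ≢m e)
  ... | no _ = refl

  coeff-P : ∀ {k} (p q : Poly k) m → coeff (p -P q) m ≡ coeff p m +ℤ (- coeff q m)
  coeff-P p q m = trans (coeff≡ev (p -P q) m) (trans (ev-++ (δ m) p (-P q))
    (cong₂ _+ℤ_ (sym (coeff≡ev p m)) (trans (ev-neg (δ m) q) (cong -_ (sym (coeff≡ev q m))))))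

  module InjectivityOn (n : ℕ) where
    open MonomialsOf n

    -- Reduced monomials are those divisible by no generator of J.  Elements of A are supported on
    -- reduced monomials and elements of J on the others, so A ∩ J = 0.
    Reduced : Mono (NV n) → Set
    Reduced μ = ∀ (v : Fin n) → (lookup μ (iA (φ v)) ≡ 0 ⊎ lookup μ (iA (χ v)) ≡ 0)
                              × (lookup μ (iB (φ v)) ≡ 0 ⊎ lookup μ (iB (χ v)) ≡ 0)

    reduced? : ∀ μ → Dec (Reduced μ)
    reduced? μ = all? (λ v → ((lookup μ (iA (φ v)) ℕ.≟ 0) ⊎-dec (lookup μ (iA (χ v)) ℕ.≟ 0))
                       ×-dec ((lookup μ (iB (φ v)) ℕ.≟ 0) ⊎-dec (lookup μ (iB (χ v)) ℕ.≟ 0)))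

    transversal-Reduced : ∀ k (T : Sub (n + n)) → inCalT {n} T ≡ true → Reduced (mono k k (aExp T) (bExp T))
    transversal-Reduced k T T∈𝒯 v = a-free , b-free
      where
      one : lookup T (φ v) xor lookup T (χ v) ≡ true
      one = allB⇒ {n} _ T∈𝒯 v
      a-free : lookup (mono k k (aExp T) (bExp T)) (iA (φ v)) ≡ 0 ⊎ lookup (mono k k (aExp T) (bExp T)) (iA (χ v)) ≡ 0
      a-free rewrite lookup-mono-a k k (aExp T) (bExp T) (φ v) | lookup-mono-a k k (aExp T) (bExp T) (χ v) =
        not-both (lookup T (φ v)) (lookup T (χ v)) one
        where
        not-both : ∀ a b → a xor b ≡ true → ind a ≡ 0 ⊎ ind b ≡ 0
        not-both false b _ = inj₁ refl
        not-both true false _ = inj₂ refl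
      b-free : lookup (mono k k (aExp T) (bExp T)) (iB (φ v)) ≡ 0 ⊎ lookup (mono k k (aExp T) (bExp T)) (iB (χ v)) ≡ 0
      b-free rewrite lookup-mono-b k k (aExp T) (bExp T) (φ v) | lookup-mono-b k k (aExp T) (bExp T) (χ v) =
        not-neither (lookup T (φ v)) (lookup T (χ v)) one
        where
        not-neither : ∀ a b → a xor b ≡ true → ind (not a) ≡ 0 ⊎ ind (not b) ≡ 0
        not-neither true b _ = inj₁ refl
        not-neither false true _ = inj₂ refl

    InA-coeff-nonReduced : ∀ p → InA n p → ∀ m → ¬ Reduced m → coeff p m ≡ + 0
    InA-coeff-nonReduced p (L , L⊆𝒯 , p≈) m ¬red =
      trans (p≈ m) (trans (coeff≡ev (sumP (map generator L)) m) (ev-sumP-0 (δ m) generator L term-0))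
      where
      generator : ℤ × Sub (n + n) × ℕ → PP n
      generator t = constP (proj₁ t) *P monoT {n} (proj₁ (proj₂ t)) *P ((s {n} *P z {n}) ^P proj₂ (proj₂ t))
      term-0 : ∀ {t} → t ∈ L → ev (δ m) (generator t) ≡ + 0
      term-0 {c , T , k} t∈ rewrite generatorA≡ c T k =
        trans (cong (λ w → (c * + 1 * + 1) * w +ℤ + 0)
                    (δ-≢ m (mono k k (aExp T) (bExp T)) (λ eq → ¬red (≡subst Reduced eq (transversal-Reduced k T (All.lookup L⊆𝒯 t∈))))))
              (trans (ℤP.+-identityʳ _) (ℤP.*-zeroʳ (c * + 1 * + 1)))

    private
      ⊕-positive : ∀ (μ u : Mono (NV n)) i → lookup u i ≡ 1 → lookup (μ ⊕ u) i ≢ 0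
      ⊕-positive μ u i u≡1 μ⊕u≡0 with () ← trans (sym u≡1) (ℕP.m+n≡0⇒n≡0 (lookup μ i) (trans (sym (lookup-zipWith ℕ._+_ i μ u)) μ⊕u≡0))

      kron-pair : ∀ {k} (i j : Fin k) → i ≢ j → kron i i ℕ.+ kron j i ≡ 1 × kron i j ℕ.+ kron j j ≡ 1
      kron-pair i j i≢j rewrite kron-refl i | kron-refl j | kron-≢ j i (λ e → i≢j (sym e)) | kron-≢ i j i≢j = refl , refl

    multiple-nonReduced : ∀ (x y : Fin (NV n)) → x ≢ y → ∀ μ m → μ ⊕ (unitM x ⊕ unitM y) ≡ m →
      lookup m x ≡ 0 ⊎ lookup m y ≡ 0 → ⊥
    multiple-nonReduced x y x≢y μ m refl (inj₁ mx≡0) = ⊕-positive μ (unitM x ⊕ unitM y) x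
      (trans (lookup-zipWith ℕ._+_ x (unitM x) (unitM y)) (trans (cong₂ ℕ._+_ (lookup-unitM x x) (lookup-unitM y x)) (proj₁ (kron-pair x y x≢y)))) mx≡0
    multiple-nonReduced x y x≢y μ m refl (inj₂ my≡0) = ⊕-positive μ (unitM x ⊕ unitM y) y
      (trans (lookup-zipWith ℕ._+_ y (unitM x) (unitM y)) (trans (cong₂ ℕ._+_ (lookup-unitM x y) (lookup-unitM y y)) (proj₂ (kron-pair x y x≢y)))) my≡0

    InJ-coeff-Reduced : ∀ r → InJ n r → ∀ m → Reduced m → coeff r m ≡ + 0
    InJ-coeff-Reduced r (f , r≈) m red =
      trans (r≈ m) (trans (coeff≡ev (sumP (map generator (allFin n))) m) (ev-sumP-0 (δ m) generator (allFin n) (λ {v} _ → generator-0 v)))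
      where
      generator : Fin n → PP n
      generator v = proj₁ (f v) *P (a {n} (φ v) *P a {n} (χ v)) +P proj₂ (f v) *P (b {n} (φ v) *P b {n} (χ v))
      multiple-0 : ∀ (x y : Fin (NV n)) → x ≢ y → (lookup m x ≡ 0 ⊎ lookup m y ≡ 0) → ∀ q →
        ev (δ m) (q *P (((+ 1 , unitM x) ∷ []) *P ((+ 1 , unitM y) ∷ []))) ≡ + 0
      multiple-0 x y x≢y free q = trans (ev-* (δ m) q _) (trans (ev-cong (λ μ →
        trans (cong (λ w → + 1 * w +ℤ + 0) (δ-≢ m (μ ⊕ (unitM x ⊕ unitM y)) (λ eq → multiple-nonReduced x y x≢y μ m eq free))) refl) q)
        (ev-0 q))
      φ≢χ : ∀ v → φ {n} v ≢ χ v
      φ≢χ v = ↑ˡ≢↑ʳ v v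
      generator-0 : ∀ v → ev (δ m) (generator v) ≡ + 0
      generator-0 v = trans (ev-++ (δ m) (proj₁ (f v) *P (a {n} (φ v) *P a {n} (χ v))) (proj₂ (f v) *P (b {n} (φ v) *P b {n} (χ v))))
        (cong₂ _+ℤ_
        (multiple-0 (iA (φ v)) (iA (χ v)) (λ e → φ≢χ v (iA-injective e)) (proj₁ (red v)) (proj₁ (f v)))
        (multiple-0 (iB (φ v)) (iB (χ v)) (λ e → φ≢χ v (iB-injective e)) (proj₂ (red v)) (proj₂ (f v))))

    π-injective-on-A : ∀ (p q : PP n) → InA n p → InA n q → SameModJ n p q → p ≈P q
    π-injective-on-A p q p∈A q∈A p-q∈J m with reduced? m
    ... | yes red = ℤP.i-j≡0⇒i≡j _ _ (trans (sym (coeff-P p q m)) (InJ-coeff-Reduced (p -P q) p-q∈J m red))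
    ... | no ¬red = trans (InA-coeff-nonReduced p p∈A m ¬red) (sym (InA-coeff-nonReduced q q∈A m ¬red))

module Congruence where

  open PolynomialRing using (_≋_; get; _⊕_)
  open PolynomialSums
  open SumsOverFin
  open Rank using (∈-filterᵇ⁻)
  open MatroidIA using (rG-full)
  open Monomials
  open import Data.Bool using (Bool; true; false; _∧_; _xor_; not)
  open import Data.Bool.Properties using (not-involutive)
  open import Data.Nat as ℕ using (ℕ; zero; suc; _+_; _∸_; _≤_; z≤n)
  import Data.Nat.Properties as ℕP
  open import Data.Integer using (ℤ; 1ℤ)
  open import Data.Fin as Fin using (Fin; zero; suc)
  open import Data.Vec using (lookup; replicate)
  open import Data.List as List using (List; map; filterᵇ; allFin)
  open import Data.List.Properties using (map-∘; map-cong)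
  open import Data.List.Relation.Unary.All as All using (All)
  open import Data.List.Membership.Propositional.Properties using (∈-map⁻)
  open import Data.Product using (_×_; _,_; proj₁; proj₂)
  open import Relation.Nullary using (yes; no)
  open import Data.Empty using (⊥-elim)
  open import Function using (_∘_)
  open import Relation.Binary.PropositionalEquality renaming (subst to ≡subst)

  firstWhere : ∀ m → (Fin m → Bool) → Fin m → Bool
  firstWhere (suc m) e zero = e zero
  firstWhere (suc m) e (suc i) = not (e zero) ∧ firstWhere m (λ j → e (suc j)) i

  firstWhere⇒ : ∀ m (e : Fin m → Bool) i → firstWhere m e i ≡ true → e i ≡ true
  firstWhere⇒ (suc m) e zero h = h
  firstWhere⇒ (suc m) e (suc i) h with e zero
  ... | false = firstWhere⇒ m (λ j → e (suc j)) i h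

  module CongruenceFor (n : ℕ) (G : LoopedGraph n) where
    open MonomialsOf n
    open SumsIn (NV n)

    private
      ALL 𝒯 : List (Sub (n + n))
      ALL = allSubsets (n + n)
      𝒯 = filterᵇ (inCalT {n}) ALL

    tauTerm rhsTerm : Sub (n + n) → PP n
    tauTerm T = monoT {n} T *P (s {n} ^P (rG G (replicate _ true) ∸ rG G T)) *P (z {n} ^P (size T ∸ rG G T))
    rhsTerm T = monoT {n} T *P ((s {n} *P z {n}) ^P (n ∸ rG G T))

    size-transversal : ∀ (T : Sub (n + n)) → inCalT {n} T ≡ true → size T ≡ n
    size-transversal T T∈𝒯 = trans (size≡ΣN T) (trans (ΣN-++ n n _) (trans (sym (ΣN-+ n _ _))
      (trans (ΣN-cong n (λ v → one-side (lookup T (φ v)) (lookup T (χ v)) (allB⇒ {n} _ T∈𝒯 v))) (ΣN-1 n))))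
      where
      one-side : ∀ a b → a xor b ≡ true → ind a + ind b ≡ 1
      one-side false true _ = refl
      one-side true false _ = refl

    -- On a transversal |T| = n = r(W), so the exponents of s and z agree.
    tauTerm≡rhsTerm : ∀ T → inCalT {n} T ≡ true → tauTerm T ≡ rhsTerm T
    tauTerm≡rhsTerm T T∈𝒯 = trans (tauTerm≡ T _ _) (trans (cong monomial
      (mono-cong (cong (_∸ rG G T) (rG-full G)) (cong (_∸ rG G T) (size-transversal T T∈𝒯)) (λ _ → refl) (λ _ → refl)))
      (sym (rhsTerm≡ T _)))

    nonTransversalPart : PP n
    nonTransversalPart = ΣP (λ T → ⟪ not (inCalT {n} T) ⟫ tauTerm T) ALL

    transversalPart≋rhs : ΣP (λ T → ⟪ inCalT {n} T ⟫ tauTerm T) ALL ≋ rhs G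
    transversalPart≋rhs = ≋-sym (≋-trans (ΣP-filter rhsTerm (inCalT {n}) ALL) (ΣP-cong ALL (λ T → by-case T (inCalT {n} T) refl)))
      where
      by-case : ∀ T b → inCalT {n} T ≡ b → ⟪ b ⟫ rhsTerm T ≋ ⟪ b ⟫ tauTerm T
      by-case T true T∈𝒯 = ≡⇒≋ (sym (tauTerm≡rhsTerm T T∈𝒯))
      by-case T false _ = ≋-refl

    rhs-tau≋ : rhs G -P tau G ≋ -P nonTransversalPart
    rhs-tau≋ = begin
        rhs G -P tau G                   ≈⟨ +P-cong (≋-refl {rhs G}) (-P-cong (ΣP-split tauTerm (inCalT {n}) ALL)) ⟩
        rhs G -P (C +P N)                ≈⟨ +P-cong (≋-refl {rhs G}) (-P-cong (+P-cong transversalPart≋rhs (≋-refl {N}))) ⟩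
        rhs G -P (rhs G +P N)            ≈⟨ +P-cong (≋-refl {rhs G}) (≋-sym (-‿+-comm (rhs G) N)) ⟩
        rhs G +P (-P rhs G +P -P N)      ≈⟨ ≋-sym (+P-assoc (rhs G) (-P rhs G) (-P N)) ⟩
        (rhs G +P -P rhs G) +P -P N      ≈⟨ +P-cong (-P-inverseʳ (rhs G)) (≋-refl { -P N}) ⟩
        0P +P -P N                       ≈⟨ +P-identityˡ (-P N) ⟩
        -P N                             ∎
      where
      C = ΣP (λ T → ⟪ inCalT {n} T ⟫ tauTerm T) ALL
      N = nonTransversalPart

    unbalanced : Sub (n + n) → Fin n → Bool
    unbalanced T v = not (lookup T (φ v) xor lookup T (χ v))

    unbalanced⇒ : ∀ T v → unbalanced T v ≡ true → lookup T (φ v) ≡ lookup T (χ v)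
    unbalanced⇒ T v e with lookup T (φ v) | lookup T (χ v)
    ... | false | false = refl
    ... | true | true = refl

    ∉𝒯⇔unbalanced : ∀ T → not (inCalT {n} T) ≡ anyB {n} (unbalanced T)
    ∉𝒯⇔unbalanced T = trans (cong not (allB≡not-anyB-not {n} (λ v → lookup T (φ v) xor lookup T (χ v)))) (not-involutive _)

    ΣP-firstWhere : ∀ m (e : Fin m → Bool) (X : PP n) → ΣP (λ v → ⟪ firstWhere m e v ⟫ X) (allFin m) ≋ ⟪ anyB e ⟫ X
    ΣP-firstWhere zero e X = ≋-refl
    ΣP-firstWhere (suc m) e X rewrite anyB-suc e with e zero in e0
    ... | true = ≋-trans (+P-cong (≋-refl {X}) (≋-trans tail (ΣP-0 _ (allFin m) (λ i _ → ≡⇒≋ (later i))))) (+P-identityʳ X)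
      where
      tail = ≡⇒≋ (ΣP-tabulate-suc m (λ v → ⟪ firstWhere (suc m) e v ⟫ X))
      later : ∀ i → ⟪ firstWhere (suc m) e (suc i) ⟫ X ≡ 0P
      later i = cong (λ c → ⟪ not c ∧ firstWhere m (λ j → e (suc j)) i ⟫ X) e0
    ... | false = ≋-trans (≡⇒≋ (ΣP-tabulate-suc m (λ v → ⟪ firstWhere (suc m) e v ⟫ X)))
                   (≋-trans (ΣP-cong (allFin m) (λ i → ≡⇒≋ (later i))) (ΣP-firstWhere m (λ j → e (suc j)) X))
      where
      later : ∀ i → ⟪ firstWhere (suc m) e (suc i) ⟫ X ≡ ⟪ firstWhere m (λ j → e (suc j)) i ⟫ X
      later i = cong (λ c → ⟪ not c ∧ firstWhere m (λ j → e (suc j)) i ⟫ X) e0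

    pairExp : Fin n → W n → ℕ
    pairExp v w = kron (φ v) w + kron (χ v) w

    pairExp≤ : ∀ (f : W n → ℕ) v → f (φ v) ≡ 1 → f (χ v) ≡ 1 → ∀ w → pairExp v w ≤ f w
    pairExp≤ f v fφ fχ w with φ {n} v Fin.≟ w | χ {n} v Fin.≟ w
    ... | yes refl | yes χ≡φ = ⊥-elim (↑ˡ≢↑ʳ v v (sym χ≡φ))
    ... | yes refl | no _ = ℕP.≤-reflexive (trans (ℕP.+-identityʳ _) (sym fφ))
    ... | no _ | yes refl = ℕP.≤-reflexive (sym fχ)
    ... | no _ | no _ = z≤n

    aPair bPair : Fin n → PP n
    aPair v = a {n} (φ v) *P a {n} (χ v)
    bPair v = b {n} (φ v) *P b {n} (χ v)

    private
      sExp zExp : Sub (n + n) → ℕ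
      sExp T = rG G (replicate _ true) ∸ rG G T
      zExp T = size T ∸ rG G T

    quotA quotB : Sub (n + n) → Fin n → PP n
    quotA T v = monomial (mono (sExp T) (zExp T) (λ w → aExp T w ∸ pairExp v w) (bExp T))
    quotB T v = monomial (mono (sExp T) (zExp T) (aExp T) (λ w → bExp T w ∸ pairExp v w))

    unit-pair-a : ∀ v → unitM (iA (φ v)) ⊕ unitM (iA (χ v)) ≡ mono 0 0 (pairExp v) 0̂
    unit-pair-a v = trans (cong₂ _⊕_ (unit-a (φ v)) (unit-a (χ v))) (mono-⊕ 0 0 (kron (φ v)) 0̂ 0 0 (kron (χ v)) 0̂)

    unit-pair-b : ∀ v → unitM (iB (φ v)) ⊕ unitM (iB (χ v)) ≡ mono 0 0 0̂ (pairExp v)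
    unit-pair-b v = trans (cong₂ _⊕_ (unit-b (φ v)) (unit-b (χ v))) (mono-⊕ 0 0 0̂ (kron (φ v)) 0 0 0̂ (kron (χ v)))

    quotA*aPair : ∀ T v → lookup T (φ v) ≡ true → lookup T (χ v) ≡ true → quotA T v *P aPair v ≡ tauTerm T
    quotA*aPair T v φ∈T χ∈T = trans (cong monomial (trans (cong (mono (sExp T) (zExp T) (λ w → aExp T w ∸ pairExp v w) (bExp T) ⊕_) (unit-pair-a v))
      (trans (mono-⊕ (sExp T) (zExp T) (λ w → aExp T w ∸ pairExp v w) (bExp T) 0 0 (pairExp v) 0̂)
        (mono-cong (ℕP.+-identityʳ _) (ℕP.+-identityʳ _)
          (λ w → ℕP.m∸n+n≡m (pairExp≤ (aExp T) v (cong ind φ∈T) (cong ind χ∈T) w)) (λ w → ℕP.+-identityʳ _)))))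
      (sym (tauTerm≡ T (sExp T) (zExp T)))

    quotB*bPair : ∀ T v → lookup T (φ v) ≡ false → lookup T (χ v) ≡ false → quotB T v *P bPair v ≡ tauTerm T
    quotB*bPair T v φ∉T χ∉T = trans (cong monomial (trans (cong (mono (sExp T) (zExp T) (aExp T) (λ w → bExp T w ∸ pairExp v w) ⊕_) (unit-pair-b v))
      (trans (mono-⊕ (sExp T) (zExp T) (aExp T) (λ w → bExp T w ∸ pairExp v w) 0 0 0̂ (pairExp v))
        (mono-cong (ℕP.+-identityʳ _) (ℕP.+-identityʳ _) (λ w → ℕP.+-identityʳ _)
          (λ w → ℕP.m∸n+n≡m (pairExp≤ (bExp T) v (cong (ind ∘ not) φ∉T) (cong (ind ∘ not) χ∉T) w))))))
      (sym (tauTerm≡ T (sExp T) (zExp T)))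

    -- Each non-transversal T is charged to its first unbalanced v, where τ's term is a multiple of
    -- a(v_φ)a(v_χ) (both in T) or of b(v_φ)b(v_χ) (neither in T).
    firstUnbalanced : Sub (n + n) → Fin n → Bool
    firstUnbalanced T = firstWhere n (unbalanced T)

    bothIn neitherIn : Fin n → Sub (n + n) → Bool
    bothIn v T = firstUnbalanced T v ∧ lookup T (φ v)
    neitherIn v T = firstUnbalanced T v ∧ not (lookup T (φ v))

    firstUnbalanced⇒ : ∀ T v → firstUnbalanced T v ≡ true → lookup T (χ v) ≡ lookup T (φ v)
    firstUnbalanced⇒ T v first = sym (unbalanced⇒ T v (firstWhere⇒ n (unbalanced T) v first))

    coeffA coeffB : Fin n → PP n
    coeffA v = -P ΣP (λ T → ⟪ bothIn v T ⟫ quotA T v) ALL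
    coeffB v = -P ΣP (λ T → ⟪ neitherIn v T ⟫ quotB T v) ALL

    coeffA*aPair : ∀ v → coeffA v *P aPair v ≋ -P ΣP (λ T → ⟪ bothIn v T ⟫ tauTerm T) ALL
    coeffA*aPair v = ≋-trans (≋-sym (-‿distribˡ-* (ΣP (λ T → ⟪ bothIn v T ⟫ quotA T v) ALL) (aPair v)))
      (-P-cong (≋-trans (ΣP-*ʳ (aPair v) _ ALL) (ΣP-cong ALL (λ T → by-case T (firstUnbalanced T v) refl (lookup T (φ v)) refl))))
      where
      by-case : ∀ T c → firstUnbalanced T v ≡ c → ∀ d → lookup T (φ v) ≡ d →
        ⟪ c ∧ d ⟫ quotA T v *P aPair v ≋ ⟪ c ∧ d ⟫ tauTerm T
      by-case T true first true φ∈T = ≡⇒≋ (quotA*aPair T v φ∈T (trans (firstUnbalanced⇒ T v first) φ∈T))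
      by-case T true first false _ = *P-zeroˡ (aPair v)
      by-case T false first d _ = *P-zeroˡ (aPair v)

    coeffB*bPair : ∀ v → coeffB v *P bPair v ≋ -P ΣP (λ T → ⟪ neitherIn v T ⟫ tauTerm T) ALL
    coeffB*bPair v = ≋-trans (≋-sym (-‿distribˡ-* (ΣP (λ T → ⟪ neitherIn v T ⟫ quotB T v) ALL) (bPair v)))
      (-P-cong (≋-trans (ΣP-*ʳ (bPair v) _ ALL) (ΣP-cong ALL (λ T → by-case T (firstUnbalanced T v) refl (lookup T (φ v)) refl))))
      where
      by-case : ∀ T c → firstUnbalanced T v ≡ c → ∀ d → lookup T (φ v) ≡ d →
        ⟪ c ∧ not d ⟫ quotB T v *P bPair v ≋ ⟪ c ∧ not d ⟫ tauTerm T
      by-case T true first false φ∉T = ≡⇒≋ (quotB*bPair T v φ∉T (trans (firstUnbalanced⇒ T v first) φ∉T))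
      by-case T true first true _ = *P-zeroˡ (bPair v)
      by-case T false first d _ = *P-zeroˡ (bPair v)

    generator-sum : ∀ v → coeffA v *P aPair v +P coeffB v *P bPair v ≋ -P ΣP (λ T → ⟪ firstUnbalanced T v ⟫ tauTerm T) ALL
    generator-sum v = ≋-trans (+P-cong (coeffA*aPair v) (coeffB*bPair v))
      (≋-trans (-‿+-comm (ΣP both ALL) (ΣP neither ALL))
        (-P-cong (≋-trans (≋-sym (ΣP-+ both neither ALL)) (ΣP-cong ALL (λ T → recombine T (firstUnbalanced T v) (lookup T (φ v)))))))
      where
      both neither : Sub (n + n) → PP n
      both T = ⟪ bothIn v T ⟫ tauTerm T
      neither T = ⟪ neitherIn v T ⟫ tauTerm T
      recombine : ∀ T c d → ⟪ c ∧ d ⟫ tauTerm T +P ⟪ c ∧ not d ⟫ tauTerm T ≋ ⟪ c ⟫ tauTerm T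
      recombine T true true = +P-identityʳ (tauTerm T)
      recombine T true false = +P-identityˡ (tauTerm T)
      recombine T false d = +P-identityˡ 0P

    rhs≡tau-mod-J : SameModJ n (rhs G) (tau G)
    rhs≡tau-mod-J = (λ v → coeffA v , coeffB v) , get (≋-trans rhs-tau≋ (≋-sym J-element≋))
      where
      J-element≋ : ΣP (λ v → coeffA v *P aPair v +P coeffB v *P bPair v) (allFin n) ≋ -P nonTransversalPart
      J-element≋ = begin
        ΣP (λ v → coeffA v *P aPair v +P coeffB v *P bPair v) (allFin n) ≈⟨ ΣP-cong (allFin n) generator-sum ⟩
        ΣP (λ v → -P ΣP (λ T → ⟪ firstUnbalanced T v ⟫ tauTerm T) ALL) (allFin n) ≈⟨ ≋-sym (ΣP-neg _ (allFin n)) ⟩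
        -P ΣP (λ v → ΣP (λ T → ⟪ firstUnbalanced T v ⟫ tauTerm T) ALL) (allFin n)
          ≈⟨ -P-cong (ΣP-swap (λ v T → ⟪ firstUnbalanced T v ⟫ tauTerm T) (allFin n) ALL) ⟩
        -P ΣP (λ T → ΣP (λ v → ⟪ firstUnbalanced T v ⟫ tauTerm T) (allFin n)) ALL
          ≈⟨ -P-cong (ΣP-cong ALL (λ T → ΣP-firstWhere n (unbalanced T) (tauTerm T))) ⟩
        -P ΣP (λ T → ⟪ anyB (unbalanced T) ⟫ tauTerm T) ALL
          ≈⟨ -P-cong (ΣP-cong ALL (λ T → ≡⇒≋ (cong (λ c → ⟪ c ⟫ tauTerm T) (sym (∉𝒯⇔unbalanced T))))) ⟩
        -P nonTransversalPart ∎

    rhs∈A : InA n (rhs G)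
    rhs∈A = generators , generators⊆𝒯 , λ m → cong (λ p → coeff p m) rhs≡
      where
      generators : List (ℤ × Sub (n + n) × ℕ)
      generators = map (λ T → (1ℤ , T , n ∸ rG G T)) 𝒯
      generators⊆𝒯 : All (λ t → inCalT {n} (proj₁ (proj₂ t)) ≡ true) generators
      generators⊆𝒯 = All.tabulate λ t∈ → let (T , T∈ , e) = ∈-map⁻ _ t∈ in
        ≡subst (λ t → inCalT {n} (proj₁ (proj₂ t)) ≡ true) (sym e) (proj₂ (∈-filterᵇ⁻ (inCalT {n}) ALL T∈))
      rhs≡ : rhs G ≡ sumP (map (λ t → constP (proj₁ t) *P monoT {n} (proj₁ (proj₂ t)) *P ((s {n} *P z {n}) ^P proj₂ (proj₂ t))) generators)
      rhs≡ = cong sumP (trans (map-cong (λ T → trans (rhsTerm≡ T (n ∸ rG G T)) (sym (generatorA≡ 1ℤ T (n ∸ rG G T)))) 𝒯) (map-∘ 𝒯))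

module Specialisation where

  open PolynomialRing using (_≋_; mk≋; get; ev≡⇒≈P)
  open PolynomialSums
  open SumsOverFin
  open Rank using (∈-allSubsets; ∈-filterᵇ⁻)
  open Steinitz using (vec-ext; allSubsets-Unique)
  open MatroidIA using (W-ext; lookup-φ; lookup-χ; size-complement)
  open TransversalRank using (transversal; rG-transversal; principalRank≤size)
  open Monomials
  open import Data.Bool using (Bool; true; false; _xor_; not)
  import Data.Bool as Bool
  open import Data.Nat as ℕ using (ℕ; zero; suc; _+_; _∸_)
  import Data.Nat.Properties as ℕP
  open import Data.Integer using (ℤ; +_)
  import Data.Integer as ℤ
  import Data.Integer.Properties as ℤP
  open import Data.Fin as Fin using (Fin; _↑ˡ_; _↑ʳ_; splitAt)
  open import Data.Fin.Properties using (splitAt-↑ˡ; splitAt-↑ʳ)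
  open import Data.Vec as Vec using (lookup; replicate; tabulate)
  open import Data.Vec.Properties using (lookup∘tabulate; lookup-map; ≡-dec)
  open import Data.List using (List; []; _∷_; map; foldr; filterᵇ; allFin)
  open import Data.List.Properties using (map-∘; map-cong)
  open import Data.List.Membership.Propositional using (_∈_)
  open import Data.List.Relation.Unary.Any using (here; there)
  open import Data.Product using (_×_; _,_; proj₁; proj₂)
  open import Data.Empty using (⊥-elim)
  open import Relation.Nullary using (yes; no; Dec)
  open import Relation.Nullary.Decidable using (⌊_⌋; isYes≗does; dec-false)
  open import Relation.Binary.PropositionalEquality renaming (subst to ≡subst)

  open SumsIn 2

  x-1 y-1 : Poly 2
  x-1 = xP -P 1P
  y-1 = yP -P 1P

  Represents : Frac → Poly 2 → Set
  Represents F Q = proj₁ F ≋ Q *P proj₂ F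

  constP-0 : constP {2} (+ 0) ≋ 0P
  constP-0 = mk≋ (ev≡⇒≈P (constP (+ 0)) 0P (λ h → trans (ℤP.+-identityʳ _) (ℤP.*-zeroˡ (h (replicate 2 0)))))

  Represents-sum : ∀ {A : Set} (F : A → Frac) (Q : A → Poly 2) (L : List A) → (∀ x → x ∈ L → Represents (F x) (Q x)) →
    Represents (foldr _+F_ (constF (+ 0)) (map F L)) (ΣP Q L)
  Represents-sum F Q [] h = ≋-trans constP-0 (≋-sym (*P-zeroˡ 1P))
  Represents-sum F Q (x ∷ L) h = add (h x (here refl)) (Represents-sum F Q L (λ y y∈ → h y (there y∈)))
    where
    N₁ = proj₁ (F x)
    D₁ = proj₂ (F x)
    N₂ = proj₁ (foldr _+F_ (constF (+ 0)) (map F L))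
    D₂ = proj₂ (foldr _+F_ (constF (+ 0)) (map F L))
    add : N₁ ≋ Q x *P D₁ → N₂ ≋ ΣP Q L *P D₂ → N₁ *P D₂ +P N₂ *P D₁ ≋ (Q x +P ΣP Q L) *P (D₁ *P D₂)
    add e₁ e₂ = begin
        N₁ *P D₂ +P N₂ *P D₁                       ≈⟨ +P-cong (*P-cong e₁ (≋-refl {D₂})) (*P-cong e₂ (≋-refl {D₁})) ⟩
        (Q x *P D₁) *P D₂ +P (ΣP Q L *P D₂) *P D₁  ≈⟨ +P-cong (*P-assoc (Q x) D₁ D₂) (≋-trans (*P-assoc (ΣP Q L) D₂ D₁) (*P-cong (≋-refl {ΣP Q L}) (*P-comm D₂ D₁))) ⟩
        Q x *P (D₁ *P D₂) +P ΣP Q L *P (D₁ *P D₂)  ≈⟨ ≋-sym (*P-distribʳ (D₁ *P D₂) (Q x) (ΣP Q L)) ⟩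
        (Q x +P ΣP Q L) *P (D₁ *P D₂)              ∎

  numerator-prod : ∀ (L : List Frac) (c : Frac) → proj₁ (foldr _*F_ c L) ≡ foldr _*P_ (proj₁ c) (map proj₁ L)
  numerator-prod [] c = refl
  numerator-prod (f ∷ L) c = cong (proj₁ f *P_) (numerator-prod L c)

  denominator-prod : ∀ (L : List Frac) (c : Frac) → proj₂ (foldr _*F_ c L) ≡ foldr _*P_ (proj₂ c) (map proj₂ L)
  denominator-prod [] c = refl
  denominator-prod (f ∷ L) c = cong (proj₂ f *P_) (denominator-prod L c)

  numerator-^F : ∀ (f : Frac) e → proj₁ (f ^F e) ≡ proj₁ f ^P e
  numerator-^F f zero = refl
  numerator-^F f (suc e) = cong (proj₁ f *P_) (numerator-^F f e)

  denominator-^F : ∀ (f : Frac) e → proj₂ (f ^F e) ≡ proj₂ f ^P e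
  denominator-^F f zero = refl
  denominator-^F f (suc e) = cong (proj₂ f *P_) (denominator-^F f e)

  sumP-singletons : ∀ {A : Set} {k} (g : A → ℤ × Mono k) (L : List A) → sumP (map (λ x → g x ∷ []) L) ≡ map g L
  sumP-singletons g [] = refl
  sumP-singletons g (x ∷ L) = cong (g x ∷_) (sumP-singletons g L)

  module SpecialisationOf (n : ℕ) (G : LoopedGraph n) where
    open MonomialsOf n

    σ : Fin (NV n) → Frac
    σ = Defs.subst n

    σ-aφ : ∀ (v : Fin n) → σ (iA (φ v)) ≡ constF (+ 1)
    σ-aφ v with splitAt (n + n) (φ {n} v ↑ˡ (n + n)) | splitAt-↑ˡ (n + n) (φ {n} v) (n + n)
    ... | _ | refl with splitAt n (φ {n} v) | splitAt-↑ˡ n v n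
    ... | _ | refl = refl

    σ-aχ : ∀ (v : Fin n) → σ (iA (χ v)) ≡ (x-1 , 1P)
    σ-aχ v with splitAt (n + n) (χ {n} v ↑ˡ (n + n)) | splitAt-↑ˡ (n + n) (χ {n} v) (n + n)
    ... | _ | refl with splitAt n (χ {n} v) | splitAt-↑ʳ n n v
    ... | _ | refl = refl

    σ-b : ∀ (w : W n) → σ (iB w) ≡ constF (+ 1)
    σ-b w with splitAt (n + n) ((n + n) ↑ʳ w) | splitAt-↑ʳ (n + n) (n + n) w
    ... | _ | refl = refl

    σ-mono : Mono (NV n) → Frac
    σ-mono μ = foldr _*F_ (constF (+ 1)) (map (λ i → σ i ^F lookup μ i) (allFin (NV n)))

    numerator-σ-mono : ∀ μ → proj₁ (σ-mono μ) ≡ ΠF (NV n) (λ i → proj₁ (σ i) ^P lookup μ i)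
    numerator-σ-mono μ = trans (numerator-prod (map (λ i → σ i ^F lookup μ i) (allFin (NV n))) (constF (+ 1)))
      (trans (cong (foldr _*P_ 1P) (trans (sym (map-∘ {g = proj₁} {f = λ i → σ i ^F lookup μ i} (allFin (NV n))))
        (map-cong (λ i → numerator-^F (σ i) (lookup μ i)) (allFin (NV n)))))
        (prodP-allFin (NV n) (λ i → proj₁ (σ i) ^P lookup μ i)))

    denominator-σ-mono : ∀ μ → proj₂ (σ-mono μ) ≡ ΠF (NV n) (λ i → proj₂ (σ i) ^P lookup μ i)
    denominator-σ-mono μ = trans (denominator-prod (map (λ i → σ i ^F lookup μ i) (allFin (NV n))) (constF (+ 1)))
      (trans (cong (foldr _*P_ 1P) (trans (sym (map-∘ {g = proj₂} {f = λ i → σ i ^F lookup μ i} (allFin (NV n))))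
        (map-cong (λ i → denominator-^F (σ i) (lookup μ i)) (allFin (NV n)))))
        (prodP-allFin (NV n) (λ i → proj₂ (σ i) ^P lookup μ i)))

    χPart : Sub (n + n) → Sub n
    χPart T = tabulate (λ v → lookup T (χ v))

    private
      μ : ℕ → Sub (n + n) → Mono (NV n)
      μ k T = mono k k (aExp T) (bExp T)

      numeratorAt denominatorAt : ℕ → Sub (n + n) → Fin ((n + n) + (n + n)) → Poly 2
      numeratorAt k T j = proj₁ (σ (Fin.suc (Fin.suc j))) ^P lookup (μ k T) (Fin.suc (Fin.suc j))
      denominatorAt k T j = proj₂ (σ (Fin.suc (Fin.suc j))) ^P lookup (μ k T) (Fin.suc (Fin.suc j))

      σ≡1⇒^≋1 : ∀ {j} → σ j ≡ constF (+ 1) → ∀ e → proj₁ (σ j) ^P e ≋ 1P × proj₂ (σ j) ^P e ≋ 1P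
      σ≡1⇒^≋1 σj≡1 e = ≋-trans (≡⇒≋ (cong (λ F → proj₁ F ^P e) σj≡1)) (1P-^P e) , ≋-trans (≡⇒≋ (cong (λ F → proj₂ F ^P e) σj≡1)) (1P-^P e)

    -- Only a(v_χ) contributes to the a,b-part: with exponent ind (v ∈ χPart T) and value x-1.
    numerator-ab : ∀ k T → ΠF ((n + n) + (n + n)) (numeratorAt k T) ≋ x-1 ^P size (χPart T)
    numerator-ab k T = begin
        ΠF _ (numeratorAt k T)
      ≈⟨ ΠF-++ (n + n) (n + n) (numeratorAt k T) ⟩
        ΠF (n + n) (λ w → numeratorAt k T (w ↑ˡ (n + n))) *P ΠF (n + n) (λ w → numeratorAt k T ((n + n) ↑ʳ w))
      ≈⟨ *P-cong (ΠF-++ n n (λ w → numeratorAt k T (w ↑ˡ (n + n))))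
                 (ΠF-1 (n + n) _ (λ w → proj₁ (σ≡1⇒^≋1 (σ-b w) (lookup (μ k T) (iB w))))) ⟩
        (ΠF n (λ v → numeratorAt k T (φ v ↑ˡ (n + n))) *P ΠF n (λ v → numeratorAt k T (χ v ↑ˡ (n + n)))) *P 1P
      ≈⟨ *P-identityʳ _ ⟩
        ΠF n (λ v → numeratorAt k T (φ v ↑ˡ (n + n))) *P ΠF n (λ v → numeratorAt k T (χ v ↑ˡ (n + n)))
      ≈⟨ *P-cong (ΠF-1 n _ (λ v → proj₁ (σ≡1⇒^≋1 (σ-aφ v) (lookup (μ k T) (iA (φ v))))))
                 (ΠF-cong n (λ v → ≡⇒≋ (cong₂ _^P_ (cong proj₁ (σ-aχ v)) (lookup-mono-a k k (aExp T) (bExp T) (χ v))))) ⟩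
        1P *P ΠF n (λ v → x-1 ^P ind (lookup T (χ v)))
      ≈⟨ *P-identityˡ _ ⟩
        ΠF n (λ v → x-1 ^P ind (lookup T (χ v)))
      ≈⟨ ΠF-^P n x-1 _ ⟩
        x-1 ^P ΣN n (λ v → ind (lookup T (χ v)))
      ≈⟨ ≡⇒≋ (cong (x-1 ^P_) (trans (ΣN-cong n (λ v → cong ind (sym (lookup∘tabulate (λ v → lookup T (χ v)) v))))
                                     (sym (size≡ΣN (χPart T))))) ⟩
        x-1 ^P size (χPart T) ∎

    denominator-ab : ∀ k T → ΠF ((n + n) + (n + n)) (denominatorAt k T) ≋ 1P
    denominator-ab k T = ≋-trans (ΠF-++ (n + n) (n + n) (denominatorAt k T)) (≋-trans (*P-cong
      (≋-trans (ΠF-++ n n (λ w → denominatorAt k T (w ↑ˡ (n + n))))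
        (≋-trans (*P-cong (ΠF-1 n _ (λ v → proj₂ (σ≡1⇒^≋1 (σ-aφ v) (lookup (μ k T) (iA (φ v))))))
                          (ΠF-1 n _ (λ v → ≋-trans (≡⇒≋ (cong (λ F → proj₂ F ^P lookup (μ k T) (iA (χ v))) (σ-aχ v)))
                                                    (1P-^P (lookup (μ k T) (iA (χ v)))))))
                 (*P-identityˡ 1P)))
      (ΠF-1 (n + n) _ (λ w → proj₂ (σ≡1⇒^≋1 (σ-b w) (lookup (μ k T) (iB w)))))) (*P-identityˡ 1P))

    numerator-term : ∀ k T → proj₁ (σ-mono (μ k T)) ≋ y-1 ^P k *P x-1 ^P size (χPart T)
    numerator-term k T = ≋-trans (≡⇒≋ (numerator-σ-mono (μ k T)))
      (*P-cong (≋-refl {y-1 ^P k}) (≋-trans (*P-cong (1P-^P k) (numerator-ab k T)) (*P-identityˡ _)))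

    denominator-term : ∀ k T → proj₂ (σ-mono (μ k T)) ≋ x-1 ^P k
    denominator-term k T = ≋-trans (≡⇒≋ (denominator-σ-mono (μ k T)))
      (≋-trans (*P-cong (1P-^P k) (*P-cong (≋-refl {x-1 ^P k}) (denominator-ab k T))) (≋-trans (*P-identityˡ _) (*P-identityʳ _)))

    interlaceTerm : Sub n → Poly 2
    interlaceTerm S = x-1 ^P principalRank G S *P y-1 ^P (size S ∸ principalRank G S)

    transversal-χPart : ∀ T → inCalT {n} T ≡ true → transversal (χPart T) ≡ T
    transversal-χPart T T∈𝒯 = W-ext (transversal (χPart T)) T
      (λ v → trans (lookup-φ (Vec.map not (χPart T)) (χPart T) v) (trans (lookup-map v not (χPart T))
        (trans (cong not (lookup∘tabulate _ v)) (other-side _ _ (allB⇒ {n} _ T∈𝒯 v)))))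
      (λ v → trans (lookup-χ (Vec.map not (χPart T)) (χPart T) v) (lookup∘tabulate _ v))
      where
      other-side : ∀ a b → a xor b ≡ true → not b ≡ a
      other-side false true _ = refl
      other-side true false _ = refl

    χPart-transversal : ∀ S → χPart (transversal S) ≡ S
    χPart-transversal S = vec-ext _ _ (λ v → trans (lookup∘tabulate _ v) (lookup-χ (Vec.map not S) S v))

    transversal∈𝒯 : ∀ S → inCalT {n} (transversal S) ≡ true
    transversal∈𝒯 S = allB⇐ {n} _ (λ v → trans (cong₂ _xor_ (trans (lookup-φ (Vec.map not S) S v) (lookup-map v not S))
                                                            (lookup-χ (Vec.map not S) S v)) (not-xor (lookup S v)))
      where
      not-xor : ∀ b → not b xor b ≡ true
      not-xor false = refl
      not-xor true = refl

    nullity-transversal : ∀ T → inCalT {n} T ≡ true → n ∸ rG G T ≡ size (χPart T) ∸ principalRank G (χPart T)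
    nullity-transversal T T∈𝒯 =
      trans (cong₂ _∸_ (sym (size-complement S)) (trans (cong (rG G) (sym (transversal-χPart T T∈𝒯))) (rG-transversal G S)))
            (ℕP.[m+n]∸[m+o]≡n∸o (size (Vec.map not S)) (size S) (principalRank G S))
      where S = χPart T

    σ-rhsTerm : Sub (n + n) → Frac
    σ-rhsTerm T = constF (+ 1) *F σ-mono (μ (n ∸ rG G T) T)

    -- (y-1)^k (x-1)^|S| / (x-1)^k with k = |S| - r(A[S]) is the term of q(G) at S.
    Represents-term : ∀ T → inCalT {n} T ≡ true → Represents (σ-rhsTerm T) (interlaceTerm (χPart T))
    Represents-term T T∈𝒯 = begin
        1P *P proj₁ (σ-mono (μ k T))                ≈⟨ *P-identityˡ _ ⟩
        proj₁ (σ-mono (μ k T))                      ≈⟨ numerator-term k T ⟩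
        y-1 ^P k *P x-1 ^P size S                   ≈⟨ *P-cong (≋-refl {y-1 ^P k}) (≋-trans (≡⇒≋ (cong (x-1 ^P_) size≡r+k)) (^P-+ x-1 r k)) ⟩
        y-1 ^P k *P (x-1 ^P r *P x-1 ^P k)          ≈⟨ ≋-sym (*P-assoc (y-1 ^P k) (x-1 ^P r) (x-1 ^P k)) ⟩
        (y-1 ^P k *P x-1 ^P r) *P x-1 ^P k          ≈⟨ *P-cong (≋-trans (*P-comm (y-1 ^P k) (x-1 ^P r))
                                                                   (*P-cong (≋-refl {x-1 ^P r}) (≡⇒≋ (cong (y-1 ^P_) (nullity-transversal T T∈𝒯)))))
                                                          (≋-refl {x-1 ^P k}) ⟩
        interlaceTerm S *P x-1 ^P k                 ≈⟨ *P-cong (≋-refl {interlaceTerm S}) (≋-sym (≋-trans (*P-identityˡ _) (denominator-term k T))) ⟩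
        interlaceTerm S *P (1P *P proj₂ (σ-mono (μ k T))) ∎
      where
      S = χPart T
      k = n ∸ rG G T
      r = principalRank G S
      size≡r+k : size S ≡ r + k
      size≡r+k = trans (sym (ℕP.m+[n∸m]≡n (principalRank≤size G S))) (cong (λ q → r + q) (sym (nullity-transversal T T∈𝒯)))

    private
      ALL 𝒯 : List (Sub (n + n))
      ALL = allSubsets (n + n)
      𝒯 = filterᵇ (inCalT {n}) ALL

      _≟W_ : (T U : Sub (n + n)) → Dec (T ≡ U)
      _≟W_ = ≡-dec Bool._≟_

      _≟V_ : (S S' : Sub n) → Dec (S ≡ S')
      _≟V_ = ≡-dec Bool._≟_

    -- T ↦ χPart T is a bijection from 𝒯(W(G)) onto the subsets of V(G), with inverse transversal.
    reindex : ΣP (λ T → interlaceTerm (χPart T)) 𝒯 ≋ interlaceQ G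
    reindex = begin
        ΣP (λ T → interlaceTerm (χPart T)) 𝒯                    ≈⟨ ΣP-filter (λ T → interlaceTerm (χPart T)) (inCalT {n}) ALL ⟩
        ΣP (λ T → ⟪ inCalT {n} T ⟫ interlaceTerm (χPart T)) ALL  ≈⟨ ΣP-cong ALL as-double-sum ⟩
        ΣP (λ T → ΣP (term T) (allSubsets n)) ALL               ≈⟨ ΣP-swap term ALL (allSubsets n) ⟩
        ΣP (λ S → ΣP (λ T → term T S) ALL) (allSubsets n)       ≈⟨ ΣP-cong (allSubsets n) single-transversal ⟩
        ΣP interlaceTerm (allSubsets n)                        ∎
      where
      term : Sub (n + n) → Sub n → Poly 2
      term T S = ⟪ ⌊ T ≟W transversal S ⌋ ⟫ interlaceTerm S
      single-transversal : ∀ S → ΣP (λ T → term T S) ALL ≋ interlaceTerm S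
      single-transversal S =
        ΣP-point _≟W_ (interlaceTerm S) ALL (transversal S) (allSubsets-Unique (n + n)) (∈-allSubsets (transversal S))
      as-double-sum : ∀ T → ⟪ inCalT {n} T ⟫ interlaceTerm (χPart T) ≋ ΣP (term T) (allSubsets n)
      as-double-sum T with inCalT {n} T in T∈𝒯
      ... | true = ≋-sym (≋-trans (ΣP-cong (allSubsets n) same-condition)
                     (ΣP-point _≟V_ (interlaceTerm (χPart T)) (allSubsets n) (χPart T) (allSubsets-Unique n) (∈-allSubsets (χPart T))))
        where
        same-condition : ∀ S → term T S ≋ ⟪ ⌊ S ≟V χPart T ⌋ ⟫ interlaceTerm (χPart T)
        same-condition S with T ≟W transversal S | S ≟V χPart T
        ... | yes _ | yes S≡ = ≡⇒≋ (cong interlaceTerm S≡)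
        ... | yes T≡ | no S≢ = ⊥-elim (S≢ (trans (sym (χPart-transversal S)) (cong χPart (sym T≡))))
        ... | no T≢ | yes S≡ = ⊥-elim (T≢ (trans (sym (transversal-χPart T T∈𝒯)) (cong transversal (sym S≡))))
        ... | no _ | no _ = ≋-refl
      ... | false = ≋-sym (ΣP-0 _ (allSubsets n) (λ S _ → ≡⇒≋ (cong (λ c → ⟪ c ⟫ interlaceTerm S) (≢⇒false S))))
        where
        ≢⇒false : ∀ S → ⌊ T ≟W transversal S ⌋ ≡ false
        ≢⇒false S = trans (isYes≗does (T ≟W transversal S)) (dec-false (T ≟W transversal S) T≢)
          where
          T≢ : T ≢ transversal S
          T≢ T≡ with () ← trans (sym T∈𝒯) (trans (cong (inCalT {n}) T≡) (transversal∈𝒯 S))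

    σ-rhs≡ : evalF σ (rhs G) ≡ foldr _+F_ (constF (+ 0)) (map σ-rhsTerm 𝒯)
    σ-rhs≡ = trans (cong (evalF σ) rhs-terms) (cong (foldr _+F_ (constF (+ 0))) (sym (map-∘ 𝒯)))
      where
      rhs-terms : rhs G ≡ map (λ T → (+ 1 , μ (n ∸ rG G T) T)) 𝒯
      rhs-terms = trans (cong sumP (map-cong (λ T → rhsTerm≡ T (n ∸ rG G T)) 𝒯))
                        (sumP-singletons (λ T → (+ 1 , μ (n ∸ rG G T) T)) 𝒯)

    σ-rhs≃interlace : evalF σ (rhs G) ≃F (interlaceQ G , 1P)
    σ-rhs≃interlace = get (≋-trans (*P-identityʳ (proj₁ E)) (≋-trans represents (*P-cong reindex (≋-refl {proj₂ E}))))
      where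
      E = evalF σ (rhs G)
      termwise : ∀ T → T ∈ 𝒯 → Represents (σ-rhsTerm T) (interlaceTerm (χPart T))
      termwise T T∈ = Represents-term T (proj₂ (∈-filterᵇ⁻ (inCalT {n}) ALL T∈))
      represents : Represents E (ΣP (λ T → interlaceTerm (χPart T)) 𝒯)
      represents = ≡subst (λ F → Represents F (ΣP (λ T → interlaceTerm (χPart T)) 𝒯)) (sym σ-rhs≡)
        (Represents-sum σ-rhsTerm (λ T → interlaceTerm (χPart T)) 𝒯 termwise)

open Injectivity using (module InjectivityOn)
open Congruence using (module CongruenceFor)
open Specialisation using (module SpecialisationOf)

mainTheorem1 : (n : ℕ) (G : LoopedGraph n) →
    (∀ (p q : PP n) → InA n p → InA n q → SameModJ n p q → p ≈P q)
    × (Σ (PP n) (λ q → InA n q × SameModJ n q (tau G)))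
    × (InA n (rhs G) × SameModJ n (rhs G) (tau G))
    × (evalF (subst n) (rhs G) ≃F (interlaceQ G , 1P))
mainTheorem1 n G =
  π-injective-on-A ,
  (rhs G , rhs∈A , rhs≡tau-mod-J) ,
  (rhs∈A , rhs≡tau-mod-J) ,
  σ-rhs≃interlace
  where
  open InjectivityOn n
  open CongruenceFor n G
  open SpecialisationOf n G
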